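{- For all nonnegative integers $l,m,n,u,v$, \[ \sum_{k=-\infty}^\infty(-1)^k\binom{l+m}{l+k}\binom{m+n}{m+k}\binom{n+l}{n+k}\binom{2u}{u+k} =\frac{(2u)!}{u!}\sum_{k=0}^\infty\frac{(l+m+n-k)!}{k!\,(l-k)!\,(m-k)!\,(n-k)!\,(u+k)!}, \] and \[ \sum_{k=-\infty}^\infty(-1)^k\binom{m+n}{m+k}\binom{m+n}{n+k}\binom{u+v}{u+k}\binom{u+v}{v+k} =\binom{u+v}{u}\sum_{k=0}^\infty\frac{(m+n)!\,(u+v+k)!}{k!\,(m-k)!\,(n-k)!\,(u+k)!\,(v+k)!}. \]
   Context: Convention: $\frac{1}{j!}=0$ for negative integers $j$, and for integers $N\ge0$ and $j$, $\binom{N}{j}=\frac{N!}{j!\,(N-j)!}$ (so it is $0$ unless $0\le j\le N$). -}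

module Defs where

open import Data.Nat as ℕ using (ℕ; zero; suc; _!)
open import Data.Nat.Properties using (_!≢0)
open import Data.Nat.Combinatorics using (_C_)
open import Data.Integer as ℤ using (ℤ; +_; -[1+_])
open import Data.Rational as ℚ using (ℚ; 0ℚ; 1ℚ; _/_; _+_; _*_; -_)

fact : ℕ → ℚ
fact n = + (n !) / 1

-- 1/j! for an integer j, with the convention 1/j! = 0 for negative j
invFact : ℤ → ℚ
invFact (+ n)    = (+ 1 / (n !)) {{n !≢0}}
invFact -[1+ _ ] = 0ℚ

-- j! for an integer j; only ever multiplied by a factor 1/i! with i < 0
-- when j < 0, so the value chosen for negative j (here 0) is irrelevant
factℤ : ℤ → ℚ
factℤ (+ n)    = fact n
factℤ -[1+ _ ] = 0ℚ

binom : ℕ → ℤ → ℚ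
binom N (+ j)    = + (N C j) / 1
binom N -[1+ _ ] = 0ℚ

sign : ℤ → ℚ
sign k = go ℤ.∣ k ∣
  where
  go : ℕ → ℚ
  go zero    = 1ℚ
  go (suc n) = - go n

sumℕ : ℕ → (ℕ → ℚ) → ℚ
sumℕ zero    f = f 0
sumℕ (suc N) f = sumℕ N f + f (suc N)

sumℤ : ℕ → (ℤ → ℚ) → ℚ
sumℤ zero    f = f (+ 0)
sumℤ (suc N) f = sumℤ N f + f (+ suc N) + f -[1+ N ]

-- Both sides are finite sums of products of inverse factorials 1/j!, which
-- vanish for j < 0; they are handled as finitely supported functions ℤ → ℚ. The Chu–Vandermonde identity
--   Σᵢ 1/(i! (b−i)! (c−i)! (d+i)!) = (b+c+d)! / (b! c! (c+d)! (b+d)!)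
-- expands a product of binomial coefficients as a sum over j of
-- 1/((j+k)! (j−k)!) times weights independent of k: once for
-- C(M+N, M+k) C(M+N, N+k), twice for the product of three binomials. The
-- alternating sum
--   Σₖ (−1)ᵏ / ((i+k)! (i−k)! (j+k)! (j−k)!) = 1 / (i! j! (i+j)!)
-- follows by induction on i from the recurrence
--   (2i+2)(2i+1) G(i+1, k) = G(i, k−1) + 2 G(i, k) + G(i, k+1),  G(i, k) = 1/((i+k)! (i−k)!).
-- Expanding each summand of the left-hand sides, exchanging the order of
-- summation and applying the alternating sum collapses the sum over k; for the
-- second identity one more Vandermonde sum evaluates the sum over the
-- remaining index.

module Submission where

open import Defs

open import Data.Empty using (⊥-elim)
open import Data.Integer as ℤ using (ℤ; +_; -[1+_]; _⊖_)
  renaming (_+_ to _+ℤ_; _-_ to _-ℤ_; -_ to -ℤ_)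
import Data.Integer.Properties as ℤP
import Data.Integer.Tactic.RingSolver as ℤRing
open import Data.Nat as ℕ using (ℕ; zero; suc; _+_; _*_; _∸_; _!)
import Data.Nat.Properties as ℕP
import Data.Nat.Tactic.RingSolver as ℕRing
open import Data.Nat.Combinatorics using (_C_; nCk≡n!/k![n-k]!; k>n⇒nCk≡0; k![n∸k]!∣n!)
open import Data.Nat.DivMod using (m/n*n≡m)
open import Data.List using (_∷_; [])
open import Data.Product using (Σ; _×_; _,_)
open import Data.Rational as ℚ using (ℚ; 0ℚ; 1ℚ; toℚᵘ)
  renaming (_+_ to _+ℚ_; _*_ to _*ℚ_; -_ to -ℚ_)
import Data.Rational.Properties as ℚP
open import Data.Rational.Solver using (module +-*-Solver)
open +-*-Solver using (_:+_; _:*_; _:=_; :-_; con; solve)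
open import Data.Rational.Unnormalised as ℚᵘ using (mkℚᵘ; *≡*)
import Data.Rational.Unnormalised.Properties as ℚᵘP
open import Data.Sum using (_⊎_; inj₁; inj₂)
open import Relation.Binary.PropositionalEquality
open import Relation.Nullary using (yes; no)

-- Integers and factorials in ℚ

ι : ℤ → ℚ
ι z = z ℚ./ 1

private
  toℚᵘ-ι : ∀ z → toℚᵘ (ι z) ℚᵘ.≃ mkℚᵘ z 0
  toℚᵘ-ι z = ℚP.toℚᵘ-fromℚᵘ (mkℚᵘ z 0)

ι-+ : ∀ a b → ι (a +ℤ b) ≡ ι a +ℚ ι b
ι-+ a b = ℚP.toℚᵘ-injective (begin
  toℚᵘ (ι (a +ℤ b))            ≈⟨ toℚᵘ-ι (a +ℤ b) ⟩
  mkℚᵘ (a +ℤ b) 0              ≈⟨ *≡* (cross a b) ⟩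
  mkℚᵘ a 0 ℚᵘ.+ mkℚᵘ b 0       ≈⟨ ℚᵘP.+-cong (ℚᵘP.≃-sym (toℚᵘ-ι a)) (ℚᵘP.≃-sym (toℚᵘ-ι b)) ⟩
  toℚᵘ (ι a) ℚᵘ.+ toℚᵘ (ι b)   ≈⟨ ℚᵘP.≃-sym (ℚP.toℚᵘ-homo-+ (ι a) (ι b)) ⟩
  toℚᵘ (ι a +ℚ ι b)            ∎)
  where
  open ℚᵘP.≃-Reasoning
  cross : ∀ a b → (a +ℤ b) ℤ.* + 1 ≡ (a ℤ.* + 1 +ℤ b ℤ.* + 1) ℤ.* + 1
  cross = ℤRing.solve-∀

ι-* : ∀ a b → ι (a ℤ.* b) ≡ ι a *ℚ ι b
ι-* a b = ℚP.toℚᵘ-injective (begin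
  toℚᵘ (ι (a ℤ.* b))           ≈⟨ toℚᵘ-ι (a ℤ.* b) ⟩
  mkℚᵘ (a ℤ.* b) 0             ≈⟨ *≡* refl ⟩
  mkℚᵘ a 0 ℚᵘ.* mkℚᵘ b 0       ≈⟨ ℚᵘP.*-cong (ℚᵘP.≃-sym (toℚᵘ-ι a)) (ℚᵘP.≃-sym (toℚᵘ-ι b)) ⟩
  toℚᵘ (ι a) ℚᵘ.* toℚᵘ (ι b)   ≈⟨ ℚᵘP.≃-sym (ℚP.toℚᵘ-homo-* (ι a) (ι b)) ⟩
  toℚᵘ (ι a *ℚ ι b)            ∎)
  where open ℚᵘP.≃-Reasoning

ι-neg : ∀ a → ι (-ℤ a) ≡ -ℚ ι a
ι-neg a = ℚP.toℚᵘ-injective (begin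
  toℚᵘ (ι (-ℤ a))    ≈⟨ toℚᵘ-ι (-ℤ a) ⟩
  mkℚᵘ (-ℤ a) 0      ≈⟨ *≡* refl ⟩
  ℚᵘ.- mkℚᵘ a 0      ≈⟨ ℚᵘP.-‿cong (ℚᵘP.≃-sym (toℚᵘ-ι a)) ⟩
  ℚᵘ.- toℚᵘ (ι a)    ≈⟨ ℚᵘP.≃-sym (ℚP.toℚᵘ-homo‿- (ι a)) ⟩
  toℚᵘ (-ℚ ι a)      ∎)
  where open ℚᵘP.≃-Reasoning

ι-- : ∀ a b → ι (a -ℤ b) ≡ ι a +ℚ -ℚ ι b
ι-- a b = trans (ι-+ a (-ℤ b)) (cong (ι a +ℚ_) (ι-neg b))

ι-suc : ∀ n → ι (+ suc n) ≡ 1ℚ +ℚ ι (+ n)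
ι-suc n = ι-+ (+ 1) (+ n)

fact-suc : ∀ n → fact (suc n) ≡ ι (+ suc n) *ℚ fact n
fact-suc n = trans (cong ι (ℤP.pos-* (suc n) (n !))) (ι-* (+ suc n) (+ (n !)))

fact*invFact : ∀ n → fact n *ℚ invFact (+ n) ≡ 1ℚ
fact*invFact n = ℚP.toℚᵘ-injective (begin
  toℚᵘ (fact n *ℚ invFact (+ n))          ≈⟨ ℚP.toℚᵘ-homo-* (fact n) (invFact (+ n)) ⟩
  toℚᵘ (fact n) ℚᵘ.* toℚᵘ (invFact (+ n)) ≈⟨ ℚᵘP.*-cong (toℚᵘ-ι (+ (n !))) (toℚᵘ-1/ (n !) {{n !≢0}}) ⟩
  mkℚᵘ (+ (n !)) 0 ℚᵘ.* mkℚᵘ (+ 1) (ℕ.pred (n !)) ≈⟨ *≡* (cross (n !) {{n !≢0}}) ⟩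
  mkℚᵘ (+ 1) 0                            ≈⟨ ℚᵘP.≃-sym (toℚᵘ-ι (+ 1)) ⟩
  toℚᵘ 1ℚ                                 ∎)
  where
  open ℚᵘP.≃-Reasoning
  open ℕP using (_!≢0)
  toℚᵘ-1/ : ∀ d .{{_ : ℕ.NonZero d}} → toℚᵘ (+ 1 ℚ./ d) ℚᵘ.≃ mkℚᵘ (+ 1) (ℕ.pred d)
  toℚᵘ-1/ (suc d) = ℚP.toℚᵘ-fromℚᵘ (mkℚᵘ (+ 1) d)
  cross : ∀ d .{{_ : ℕ.NonZero d}} → (+ d ℤ.* + 1) ℤ.* + 1 ≡ + 1 ℤ.* + (1 * suc (ℕ.pred d))
  cross (suc d) = cong +_ (ℕRing.solve (d ∷ []))

invFact-pred : ∀ x → invFact (x -ℤ + 1) ≡ ι x *ℚ invFact x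
invFact-pred (+ zero)  = refl
invFact-pred (+ suc n) = begin
  invFact (+ n)                                          ≡⟨ sym (ℚP.*-identityˡ _) ⟩
  1ℚ *ℚ invFact (+ n)                                    ≡⟨ cong (_*ℚ invFact (+ n)) (sym (fact*invFact (suc n))) ⟩
  fact (suc n) *ℚ invFact (+ suc n) *ℚ invFact (+ n)     ≡⟨ cong (λ f → f *ℚ invFact (+ suc n) *ℚ invFact (+ n)) (fact-suc n) ⟩
  ι (+ suc n) *ℚ fact n *ℚ invFact (+ suc n) *ℚ invFact (+ n)
    ≡⟨ solve 4 (λ s f i i' → s :* f :* i :* i' := s :* i :* (f :* i')) refl (ι (+ suc n)) (fact n) (invFact (+ suc n)) (invFact (+ n)) ⟩
  ι (+ suc n) *ℚ invFact (+ suc n) *ℚ (fact n *ℚ invFact (+ n)) ≡⟨ cong (ι (+ suc n) *ℚ invFact (+ suc n) *ℚ_) (fact*invFact n) ⟩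
  ι (+ suc n) *ℚ invFact (+ suc n) *ℚ 1ℚ                 ≡⟨ ℚP.*-identityʳ _ ⟩
  ι (+ suc n) *ℚ invFact (+ suc n)                       ∎
  where open ≡-Reasoning
invFact-pred -[1+ n ] = sym (ℚP.*-zeroʳ (ι -[1+ n ]))

invFact-suc : ∀ x → invFact x ≡ ι (+ 1 +ℤ x) *ℚ invFact (+ 1 +ℤ x)
invFact-suc x = trans (cong invFact (pred-suc x)) (invFact-pred (+ 1 +ℤ x))
  where
  pred-suc : ∀ x → x ≡ + 1 +ℤ x -ℤ + 1
  pred-suc = ℤRing.solve-∀

fact*invFact-suc : ∀ n → fact n *ℚ invFact (+ suc n) *ℚ ι (+ suc n) ≡ 1ℚ
fact*invFact-suc n = begin
  fact n *ℚ invFact (+ suc n) *ℚ ι (+ suc n)   ≡⟨ solve 3 (λ f i x → f :* i :* x := f :* (x :* i)) refl (fact n) (invFact (+ suc n)) (ι (+ suc n)) ⟩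
  fact n *ℚ (ι (+ suc n) *ℚ invFact (+ suc n)) ≡⟨ cong (fact n *ℚ_) (sym (invFact-suc (+ n))) ⟩
  fact n *ℚ invFact (+ n)                      ≡⟨ fact*invFact n ⟩
  1ℚ                                           ∎
  where open ≡-Reasoning

i<j⇒i-j<0 : ∀ {i j} → i ℤ.< j → i -ℤ j ℤ.< + 0
i<j⇒i-j<0 {i} {j} i<j = subst (i -ℤ j ℤ.<_) (ℤP.+-inverseʳ j) (ℤP.+-monoˡ-< (-ℤ j) i<j)

m<n⇒m⊖n<0 : ∀ {m n} → m ℕ.< n → m ⊖ n ℤ.< + 0
m<n⇒m⊖n<0 {m} {n} m<n = subst (ℤ._< + 0) (ℤP.[+m]-[+n]≡m⊖n m n) (i<j⇒i-j<0 (ℤ.+<+ m<n))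

invFact-neg : ∀ {x} → x ℤ.< + 0 → invFact x ≡ 0ℚ
invFact-neg { -[1+ _ ]} _           = refl
invFact-neg {+ _}      (ℤ.+<+ ())

invFact*invFact-neg : ∀ y z → y +ℤ z ℤ.< + 0 → invFact y *ℚ invFact z ≡ 0ℚ
invFact*invFact-neg -[1+ _ ] z _ = ℚP.*-zeroˡ (invFact z)
invFact*invFact-neg (+ m) -[1+ _ ] _ = ℚP.*-zeroʳ (invFact (+ m))
invFact*invFact-neg (+ m) (+ n) (ℤ.+<+ ())

-- For x < 0, factℤ x is a junk value, but then invFact y * invFact z = 0.
factℤ*invFact-cancel : ∀ x y z → y +ℤ z ℤ.≤ x +ℤ x → factℤ x *ℚ invFact x *ℚ (invFact y *ℚ invFact z) ≡ invFact y *ℚ invFact z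
factℤ*invFact-cancel (+ n) y z _ = trans (cong (_*ℚ (invFact y *ℚ invFact z)) (fact*invFact n)) (ℚP.*-identityˡ _)
factℤ*invFact-cancel x@(-[1+ n ]) y z y+z≤2x =
  trans (cong (factℤ x *ℚ invFact x *ℚ_) yz≡0) (trans (ℚP.*-zeroʳ (factℤ x *ℚ invFact x)) (sym yz≡0))
  where
  yz≡0 : invFact y *ℚ invFact z ≡ 0ℚ
  yz≡0 = invFact*invFact-neg y z (ℤP.≤-<-trans y+z≤2x ℤ.-<+)

nCk*k!*[n∸k]! : ∀ {n k} → k ℕ.≤ n → (n C k) * (k ! * (n ∸ k) !) ≡ n !
nCk*k!*[n∸k]! {n} {k} k≤n = trans (cong (_* (k ! * (n ∸ k) !)) (nCk≡n!/k![n-k]! k≤n))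
  (m/n*n≡m {{k !* (n ∸ k) !≢0}} (k![n∸k]!∣n! k≤n))
  where open ℕP using (_!*_!≢0)

binom-invFact : ∀ N j → binom N j ≡ fact N *ℚ invFact j *ℚ invFact (+ N -ℤ j)
binom-invFact N -[1+ j ] = sym (trans (cong (_*ℚ invFact (+ N -ℤ -[1+ j ])) (ℚP.*-zeroʳ (fact N)))
                                     (ℚP.*-zeroˡ (invFact (+ N -ℤ -[1+ j ]))))
binom-invFact N (+ k) with k ℕ.≤? N
... | yes k≤N = begin
  ι (+ (N C k))                                           ≡⟨ sym (ℚP.*-identityʳ _) ⟩
  ι (+ (N C k)) *ℚ 1ℚ                                     ≡⟨ cong (ι (+ (N C k)) *ℚ_) (sym one) ⟩
  ι (+ (N C k)) *ℚ ((fact k *ℚ invFact (+ k)) *ℚ (fact (N ∸ k) *ℚ invFact (+ (N ∸ k))))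
    ≡⟨ solve 5 (λ c f i f' i' → c :* ((f :* i) :* (f' :* i')) := (c :* (f :* f')) :* i :* i') refl
         (ι (+ (N C k))) (fact k) (invFact (+ k)) (fact (N ∸ k)) (invFact (+ (N ∸ k))) ⟩
  (ι (+ (N C k)) *ℚ (fact k *ℚ fact (N ∸ k))) *ℚ invFact (+ k) *ℚ invFact (+ (N ∸ k))
    ≡⟨ cong (λ f → f *ℚ invFact (+ k) *ℚ invFact (+ (N ∸ k))) fact-split ⟩
  fact N *ℚ invFact (+ k) *ℚ invFact (+ (N ∸ k))
    ≡⟨ cong (λ z → fact N *ℚ invFact (+ k) *ℚ invFact z) (sym (trans (ℤP.[+m]-[+n]≡m⊖n N k) (ℤP.⊖-≥ k≤N))) ⟩
  fact N *ℚ invFact (+ k) *ℚ invFact (+ N -ℤ + k)         ∎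
  where
  open ≡-Reasoning
  one : (fact k *ℚ invFact (+ k)) *ℚ (fact (N ∸ k) *ℚ invFact (+ (N ∸ k))) ≡ 1ℚ
  one = trans (cong₂ _*ℚ_ (fact*invFact k) (fact*invFact (N ∸ k))) (ℚP.*-identityˡ 1ℚ)
  fact-split : ι (+ (N C k)) *ℚ (fact k *ℚ fact (N ∸ k)) ≡ fact N
  fact-split = begin
    ι (+ (N C k)) *ℚ (ι (+ (k !)) *ℚ ι (+ ((N ∸ k) !)))  ≡⟨ cong (ι (+ (N C k)) *ℚ_) (sym (ι-* (+ (k !)) _)) ⟩
    ι (+ (N C k)) *ℚ ι (+ (k !) ℤ.* + ((N ∸ k) !))      ≡⟨ sym (ι-* (+ (N C k)) _) ⟩
    ι (+ (N C k) ℤ.* (+ (k !) ℤ.* + ((N ∸ k) !)))       ≡⟨ cong (λ z → ι (+ (N C k) ℤ.* z)) (sym (ℤP.pos-* (k !) _)) ⟩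
    ι (+ (N C k) ℤ.* + (k ! * (N ∸ k) !))               ≡⟨ cong ι (sym (ℤP.pos-* (N C k) _)) ⟩
    ι (+ ((N C k) * (k ! * (N ∸ k) !)))                 ≡⟨ cong (λ z → ι (+ z)) (nCk*k!*[n∸k]! k≤N) ⟩
    fact N                                              ∎
... | no k≰N = begin
  ι (+ (N C k))                                    ≡⟨ cong (λ z → ι (+ z)) (k>n⇒nCk≡0 N<k) ⟩
  0ℚ                                               ≡⟨ sym (ℚP.*-zeroʳ (fact N *ℚ invFact (+ k))) ⟩
  fact N *ℚ invFact (+ k) *ℚ 0ℚ                    ≡⟨ cong (fact N *ℚ invFact (+ k) *ℚ_) (sym (invFact-neg (i<j⇒i-j<0 (ℤ.+<+ N<k)))) ⟩
  fact N *ℚ invFact (+ k) *ℚ invFact (+ N -ℤ + k)  ∎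
  where
  open ≡-Reasoning
  N<k = ℕP.≰⇒> k≰N

binom-outside : ∀ N j → j ℤ.< + 0 ⊎ + N ℤ.< j → binom N j ≡ 0ℚ
binom-outside N j (inj₁ j<0) = trans (binom-invFact N j)
  (trans (cong (λ w → fact N *ℚ w *ℚ invFact (+ N -ℤ j)) (invFact-neg j<0))
         (solve 2 (λ f x → f :* con 0ℚ :* x := con 0ℚ) refl (fact N) (invFact (+ N -ℤ j))))
binom-outside N j (inj₂ N<j) = trans (binom-invFact N j)
  (trans (cong (fact N *ℚ invFact j *ℚ_) (invFact-neg (i<j⇒i-j<0 N<j))) (ℚP.*-zeroʳ (fact N *ℚ invFact j)))

-- Finitely supported functions on ℤ

sumℤ-cong : ∀ N {f g : ℤ → ℚ} → (∀ k → f k ≡ g k) → sumℤ N f ≡ sumℤ N g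
sumℤ-cong zero    f≗g = f≗g (+ 0)
sumℤ-cong (suc N) f≗g = cong₂ _+ℚ_ (cong₂ _+ℚ_ (sumℤ-cong N f≗g) (f≗g _)) (f≗g _)

sumℤ-+ : ∀ N f g → sumℤ N (λ k → f k +ℚ g k) ≡ sumℤ N f +ℚ sumℤ N g
sumℤ-+ zero    f g = refl
sumℤ-+ (suc N) f g =
  trans (cong (λ s → s +ℚ (f (+ suc N) +ℚ g (+ suc N)) +ℚ (f -[1+ N ] +ℚ g -[1+ N ])) (sumℤ-+ N f g))
        (solve 6 (λ s t a b c d → s :+ t :+ (a :+ b) :+ (c :+ d) := s :+ a :+ c :+ (t :+ b :+ d)) refl
               (sumℤ N f) (sumℤ N g) (f (+ suc N)) (g (+ suc N)) (f -[1+ N ]) (g -[1+ N ]))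

sumℤ-*ˡ : ∀ N c f → sumℤ N (λ k → c *ℚ f k) ≡ c *ℚ sumℤ N f
sumℤ-*ˡ zero    c f = refl
sumℤ-*ˡ (suc N) c f = trans (cong (λ s → s +ℚ c *ℚ f (+ suc N) +ℚ c *ℚ f -[1+ N ]) (sumℤ-*ˡ N c f))
  (solve 4 (λ c s a b → c :* s :+ c :* a :+ c :* b := c :* (s :+ a :+ b)) refl c (sumℤ N f) (f (+ suc N)) (f -[1+ N ]))

sumℤ-*ʳ : ∀ N f c → sumℤ N f *ℚ c ≡ sumℤ N (λ k → f k *ℚ c)
sumℤ-*ʳ N f c = trans (ℚP.*-comm (sumℤ N f) c)
  (trans (sym (sumℤ-*ˡ N c f)) (sumℤ-cong N (λ k → ℚP.*-comm c (f k))))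

sumℤ*sumℤ : ∀ N f g → sumℤ N f *ℚ sumℤ N g ≡ sumℤ N (λ i → sumℤ N (λ j → f i *ℚ g j))
sumℤ*sumℤ N f g = trans (sumℤ-*ʳ N f (sumℤ N g)) (sumℤ-cong N (λ i → sym (sumℤ-*ˡ N (f i) g)))

sumℕ≡sumℤ : ∀ N (h : ℤ → ℚ) → (∀ n → h -[1+ n ] ≡ 0ℚ) → sumℕ N (λ k → h (+ k)) ≡ sumℤ N h
sumℕ≡sumℤ zero    h h-neg = refl
sumℕ≡sumℤ (suc N) h h-neg = trans (cong (_+ℚ h (+ suc N)) (sumℕ≡sumℤ N h h-neg))
  (trans (sym (ℚP.+-identityʳ _)) (cong (sumℤ N h +ℚ h (+ suc N) +ℚ_) (sym (h-neg N))))

VanishesOutside : ℕ → (ℤ → ℚ) → Set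
VanishesOutside N f = ∀ k → N ℕ.< ℤ.∣ k ∣ → f k ≡ 0ℚ

HasSum : (ℤ → ℚ) → ℚ → Set
HasSum f s = Σ ℕ λ N → VanishesOutside N f × sumℤ N f ≡ s

vanishesOutside-mono : ∀ {N M f} → N ℕ.≤ M → VanishesOutside N f → VanishesOutside M f
vanishesOutside-mono N≤M f-vanishes k M<k = f-vanishes k (ℕP.≤-<-trans N≤M M<k)

vanishesOutside-shift : ∀ c {N f} → VanishesOutside N f → VanishesOutside (ℤ.∣ c ∣ + N) (λ k → f (c +ℤ k))
vanishesOutside-shift c {N} f-vanishes k c+N<k = f-vanishes (c +ℤ k) (ℕP.+-cancelˡ-< ℤ.∣ c ∣ _ _ (ℕP.<-≤-trans c+N<k k≤))
  where
  cancel : ∀ c k → -ℤ c +ℤ (c +ℤ k) ≡ k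
  cancel = ℤRing.solve-∀
  k≤ : ℤ.∣ k ∣ ℕ.≤ ℤ.∣ c ∣ + ℤ.∣ c +ℤ k ∣
  k≤ = subst₂ ℕ._≤_ (cong ℤ.∣_∣ (cancel c k)) (cong (_+ ℤ.∣ c +ℤ k ∣) (ℤP.∣-i∣≡∣i∣ c))
         (ℤP.∣i+j∣≤∣i∣+∣j∣ (-ℤ c) (c +ℤ k))

sumℤ-extend : ∀ d N f → VanishesOutside N f → sumℤ (d + N) f ≡ sumℤ N f
sumℤ-extend zero    N f f-vanishes = refl
sumℤ-extend (suc d) N f f-vanishes = begin
  sumℤ (d + N) f +ℚ f (+ suc (d + N)) +ℚ f -[1+ d + N ]
    ≡⟨ cong₂ _+ℚ_ (cong₂ _+ℚ_ (sumℤ-extend d N f f-vanishes) (f-vanishes _ N<)) (f-vanishes _ N<) ⟩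
  sumℤ N f +ℚ 0ℚ +ℚ 0ℚ  ≡⟨ trans (ℚP.+-identityʳ _) (ℚP.+-identityʳ _) ⟩
  sumℤ N f              ∎
  where
  open ≡-Reasoning
  N< : N ℕ.< suc (d + N)
  N< = ℕ.s≤s (ℕP.m≤n+m N d)

sumℤ-window : ∀ {N M f} → VanishesOutside N f → VanishesOutside M f → sumℤ N f ≡ sumℤ M f
sumℤ-window {N} {M} {f} N-vanishes M-vanishes with ℕP.≤-total N M
... | inj₁ N≤M = trans (sym (sumℤ-extend (M ∸ N) N f N-vanishes)) (cong (λ W → sumℤ W f) (ℕP.m∸n+n≡m N≤M))
... | inj₂ M≤N = trans (cong (λ W → sumℤ W f) (sym (ℕP.m∸n+n≡m M≤N))) (sumℤ-extend (N ∸ M) M f M-vanishes)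

HasSum-sumℤ : ∀ {f s R} → HasSum f s → VanishesOutside R f → sumℤ R f ≡ s
HasSum-sumℤ (N , N-vanishes , sum≡s) R-vanishes = trans (sumℤ-window R-vanishes N-vanishes) sum≡s

HasSum-window : ∀ {N f} → VanishesOutside N f → HasSum f (sumℤ N f)
HasSum-window {N} f-vanishes = N , f-vanishes , refl

HasSum-unique : ∀ {f s t} → HasSum f s → HasSum f t → s ≡ t
HasSum-unique (N , N-vanishes , sum≡s) f-has-t = trans (sym sum≡s) (HasSum-sumℤ f-has-t N-vanishes)

HasSum-cong : ∀ {f g s} → (∀ k → f k ≡ g k) → HasSum f s → HasSum g s
HasSum-cong f≗g (N , N-vanishes , sum≡s) =
  N , (λ k N<k → trans (sym (f≗g k)) (N-vanishes k N<k)) , trans (sym (sumℤ-cong N f≗g)) sum≡s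

HasSum-zero : ∀ {f} → (∀ k → f k ≡ 0ℚ) → HasSum f 0ℚ
HasSum-zero f≗0 = 0 , (λ k _ → f≗0 k) , f≗0 (+ 0)

HasSum-+ : ∀ {f g s t} → HasSum f s → HasSum g t → HasSum (λ k → f k +ℚ g k) (s +ℚ t)
HasSum-+ {f} {g} f-has-s@(N , N-vanishes , _) g-has-t@(M , M-vanishes , _) =
  N ℕ.⊔ M ,
  (λ k lt → trans (cong₂ _+ℚ_ (f-vanishes k lt) (g-vanishes k lt)) (ℚP.+-identityʳ 0ℚ)) ,
  trans (sumℤ-+ (N ℕ.⊔ M) f g) (cong₂ _+ℚ_ (HasSum-sumℤ f-has-s f-vanishes) (HasSum-sumℤ g-has-t g-vanishes))
  where
  f-vanishes : VanishesOutside (N ℕ.⊔ M) f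
  f-vanishes = vanishesOutside-mono (ℕP.m≤m⊔n N M) N-vanishes
  g-vanishes : VanishesOutside (N ℕ.⊔ M) g
  g-vanishes = vanishesOutside-mono (ℕP.m≤n⊔m N M) M-vanishes

HasSum-*ˡ : ∀ {f s} c → HasSum f s → HasSum (λ k → c *ℚ f k) (c *ℚ s)
HasSum-*ˡ {f} c (N , N-vanishes , sum≡s) =
  N , (λ k lt → trans (cong (c *ℚ_) (N-vanishes k lt)) (ℚP.*-zeroʳ c)) , trans (sumℤ-*ˡ N c f) (cong (c *ℚ_) sum≡s)

HasSum-sumℤ-family : ∀ M {F : ℤ → ℤ → ℚ} {s : ℤ → ℚ} →
  (∀ j → HasSum (F j) (s j)) → HasSum (λ k → sumℤ M (λ j → F j k)) (sumℤ M s)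
HasSum-sumℤ-family zero    F-has-s = F-has-s (+ 0)
HasSum-sumℤ-family (suc M) F-has-s = HasSum-+ (HasSum-+ (HasSum-sumℤ-family M F-has-s) (F-has-s _)) (F-has-s _)

sumℤ-shift : ∀ R f → sumℤ R (λ k → f (+ 1 +ℤ k)) +ℚ f (-ℤ + R) ≡ sumℤ R f +ℚ f (+ suc R)
sumℤ-shift zero    f = ℚP.+-comm (f (+ 1)) (f (+ 0))
sumℤ-shift (suc R) f = begin
  sumℤ R g +ℚ f (+ suc (suc R)) +ℚ f (+ 1 +ℤ -[1+ R ]) +ℚ f -[1+ R ]
    ≡⟨ cong (λ z → sumℤ R g +ℚ f (+ suc (suc R)) +ℚ f z +ℚ f -[1+ R ]) (1+[-1-R] R) ⟩
  sumℤ R g +ℚ f (+ suc (suc R)) +ℚ f (-ℤ + R) +ℚ f -[1+ R ]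
    ≡⟨ solve 4 (λ a b c d → a :+ b :+ c :+ d := (a :+ c) :+ b :+ d) refl (sumℤ R g) (f (+ suc (suc R))) (f (-ℤ + R)) (f -[1+ R ]) ⟩
  (sumℤ R g +ℚ f (-ℤ + R)) +ℚ f (+ suc (suc R)) +ℚ f -[1+ R ]
    ≡⟨ cong (λ z → z +ℚ f (+ suc (suc R)) +ℚ f -[1+ R ]) (sumℤ-shift R f) ⟩
  sumℤ R f +ℚ f (+ suc R) +ℚ f (+ suc (suc R)) +ℚ f -[1+ R ]
    ≡⟨ solve 4 (λ a b c d → a :+ b :+ c :+ d := a :+ b :+ d :+ c) refl (sumℤ R f) (f (+ suc R)) (f (+ suc (suc R))) (f -[1+ R ]) ⟩
  sumℤ (suc R) f +ℚ f (+ suc (suc R)) ∎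
  where
  open ≡-Reasoning
  g = λ k → f (+ 1 +ℤ k)
  1+[-1-R] : ∀ R → + 1 +ℤ -[1+ R ] ≡ -ℤ + R
  1+[-1-R] zero    = refl
  1+[-1-R] (suc R) = ℤP.[1+m]⊖[1+n]≡m⊖n 0 (suc R)

HasSum-shift1 : ∀ {f s} → HasSum f s → HasSum (λ k → f (+ 1 +ℤ k)) s
HasSum-shift1 {f} {s} (N , N-vanishes , sum≡s) = suc N , vanishesOutside-shift (+ 1) N-vanishes , (begin
  sumℤ (suc N) g                                   ≡⟨ sym (ℚP.+-identityʳ _) ⟩
  sumℤ (suc N) g +ℚ 0ℚ                             ≡⟨ cong (sumℤ (suc N) g +ℚ_) (sym (N-vanishes -[1+ N ] N<1+N)) ⟩
  sumℤ (suc N) g +ℚ f -[1+ N ]                     ≡⟨ sumℤ-shift (suc N) f ⟩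
  sumℤ N f +ℚ f (+ suc N) +ℚ f -[1+ N ] +ℚ f (+ suc (suc N))
    ≡⟨ cong₂ _+ℚ_ (cong₂ _+ℚ_ (cong₂ _+ℚ_ sum≡s (N-vanishes _ N<1+N)) (N-vanishes _ N<1+N)) (N-vanishes _ (ℕP.m<n⇒m<1+n N<1+N)) ⟩
  s +ℚ 0ℚ +ℚ 0ℚ +ℚ 0ℚ                              ≡⟨ solve 1 (λ s → s :+ con 0ℚ :+ con 0ℚ :+ con 0ℚ := s) refl s ⟩
  s                                                ∎)
  where
  open ≡-Reasoning
  g = λ k → f (+ 1 +ℤ k)
  N<1+N = ℕP.n<1+n N

-- The shifted function is finitely supported, so it has some sum, and shifting
-- it back by +1 identifies that sum with s.
HasSum-shift-1 : ∀ {f s} → HasSum f s → HasSum (λ k → f (-[1+ 0 ] +ℤ k)) s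
HasSum-shift-1 {f} f-has-s@(N , N-vanishes , _) =
  subst (HasSum g) (HasSum-unique (HasSum-cong (λ k → cong f (cancel k)) (HasSum-shift1 g-has-sum)) f-has-s) g-has-sum
  where
  g = λ k → f (-[1+ 0 ] +ℤ k)
  g-has-sum : HasSum g (sumℤ (suc N) g)
  g-has-sum = HasSum-window (vanishesOutside-shift -[1+ 0 ] N-vanishes)
  cancel : ∀ k → -[1+ 0 ] +ℤ (+ 1 +ℤ k) ≡ k
  cancel = ℤRing.solve-∀

HasSum-shift : ∀ c {f s} → HasSum f s → HasSum (λ k → f (c +ℤ k)) s
HasSum-shift (+ zero)     {f} f-has-s = HasSum-cong (λ k → cong f (sym (ℤP.+-identityˡ k))) f-has-s
HasSum-shift (+ suc n)    {f} f-has-s =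
  HasSum-cong (λ k → cong f (assoc k)) (HasSum-shift1 (HasSum-shift (+ n) f-has-s))
  where
  assoc : ∀ k → + n +ℤ (+ 1 +ℤ k) ≡ + suc n +ℤ k
  assoc k = trans (sym (ℤP.+-assoc (+ n) (+ 1) k)) (cong (_+ℤ k) (ℤP.+-comm (+ n) (+ 1)))
HasSum-shift -[1+ zero ]  f-has-s = HasSum-shift-1 f-has-s
HasSum-shift -[1+ suc n ] {f} f-has-s =
  HasSum-cong (λ k → cong f (assoc k)) (HasSum-shift-1 (HasSum-shift -[1+ n ] f-has-s))
  where
  assoc : ∀ k → -[1+ n ] +ℤ (-[1+ 0 ] +ℤ k) ≡ -[1+ suc n ] +ℤ k
  assoc k = trans (sym (ℤP.+-assoc -[1+ n ] -[1+ 0 ] k)) (cong (_+ℤ k) (ℤP.+-comm -[1+ n ] -[1+ 0 ]))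

HasSum-point : ∀ p {f} → (∀ k → k ≢ p → f k ≡ 0ℚ) → HasSum f (f p)
HasSum-point p {f} f-vanishes = HasSum-cong (λ k → cong f (p+[-p+k] k)) (HasSum-shift (-ℤ p) at-0)
  where
  p+[-p+k] : ∀ k → p +ℤ (-ℤ p +ℤ k) ≡ k
  p+[-p+k] k = trans (sym (ℤP.+-assoc p (-ℤ p) k)) (trans (cong (_+ℤ k) (ℤP.+-inverseʳ p)) (ℤP.+-identityˡ k))
  g : ℤ → ℚ
  g k = f (p +ℤ k)
  g-vanishes : VanishesOutside 0 g
  g-vanishes k 0<∣k∣ = f-vanishes (p +ℤ k) λ p+k≡p → ℕP.<-irrefl (sym (cong ℤ.∣_∣ (k≡0 p+k≡p))) 0<∣k∣
    where
    cancel : ∀ p k → -ℤ p +ℤ (p +ℤ k) ≡ k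
    cancel = ℤRing.solve-∀
    k≡0 : p +ℤ k ≡ p → k ≡ + 0
    k≡0 p+k≡p = trans (sym (cancel p k)) (trans (cong (-ℤ p +ℤ_) p+k≡p) (ℤP.+-inverseˡ p))
  at-0 : HasSum g (f p)
  at-0 = 0 , g-vanishes , cong f (ℤP.+-identityʳ p)

HasSum-cancelˡ : ∀ {f s} κ c → κ *ℚ c ≡ 1ℚ → HasSum (λ k → c *ℚ f k) (c *ℚ s) → HasSum f s
HasSum-cancelˡ {f} {s} κ c κc≡1 cf-has-cs =
  subst (HasSum f) (cancel s) (HasSum-cong (λ k → cancel (f k)) (HasSum-*ˡ κ cf-has-cs))
  where
  cancel : ∀ x → κ *ℚ (c *ℚ x) ≡ x
  cancel x = trans (sym (ℚP.*-assoc κ c x)) (trans (cong (_*ℚ x) κc≡1) (ℚP.*-identityˡ x))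

-- The Chu–Vandermonde identity

binomOverFact : ℕ → ℤ → ℚ
binomOverFact n x = invFact x *ℚ invFact (+ n -ℤ x)

binomOverFact-pascal : ∀ n x → binomOverFact n (x -ℤ + 1) +ℚ binomOverFact n x ≡ ι (+ suc n) *ℚ binomOverFact (suc n) x
binomOverFact-pascal n x = begin
  invFact (x -ℤ + 1) *ℚ invFact (+ n -ℤ (x -ℤ + 1)) +ℚ invFact x *ℚ invFact (+ n -ℤ x)
    ≡⟨ cong₂ (λ u v → invFact (x -ℤ + 1) *ℚ invFact u +ℚ invFact x *ℚ invFact v) (e₁ (+ n) x) (e₂ (+ n) x) ⟩
  invFact (x -ℤ + 1) *ℚ invFact y +ℚ invFact x *ℚ invFact (y -ℤ + 1)
    ≡⟨ cong₂ (λ u v → u *ℚ invFact y +ℚ invFact x *ℚ v) (invFact-pred x) (invFact-pred y) ⟩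
  ι x *ℚ invFact x *ℚ invFact y +ℚ invFact x *ℚ (ι y *ℚ invFact y)
    ≡⟨ solve 4 (λ a b u v → a :* u :* v :+ u :* (b :* v) := (a :+ b) :* (u :* v)) refl (ι x) (ι y) (invFact x) (invFact y) ⟩
  (ι x +ℚ ι y) *ℚ (invFact x *ℚ invFact y)
    ≡⟨ cong (_*ℚ (invFact x *ℚ invFact y)) (trans (sym (ι-+ x y)) (cong ι (e₃ (+ n) x))) ⟩
  ι (+ suc n) *ℚ (invFact x *ℚ invFact y) ∎
  where
  open ≡-Reasoning
  y = + suc n -ℤ x
  e₁ : ∀ m x → m -ℤ (x -ℤ + 1) ≡ + 1 +ℤ m -ℤ x
  e₁ = ℤRing.solve-∀
  e₂ : ∀ m x → m -ℤ x ≡ + 1 +ℤ m -ℤ x -ℤ + 1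
  e₂ = ℤRing.solve-∀
  e₃ : ∀ m x → x +ℤ (+ 1 +ℤ m -ℤ x) ≡ + 1 +ℤ m
  e₃ = ℤRing.solve-∀

binomOverFact-zero : ∀ x → x ≢ + 0 → binomOverFact 0 x ≡ 0ℚ
binomOverFact-zero x@(-[1+ _ ]) _   = ℚP.*-zeroˡ (invFact (+ 0 -ℤ x))
binomOverFact-zero (+ zero)      x≢0 = ⊥-elim (x≢0 refl)
binomOverFact-zero x@(+ suc _)   _   = ℚP.*-zeroʳ (invFact x)

chuVandermondeTerm : ℕ → ℕ → ℤ → ℤ → ℚ
chuVandermondeTerm a b c i = binomOverFact b i *ℚ binomOverFact a (c -ℤ i)

chuVandermondeValue : ℕ → ℕ → ℤ → ℚ
chuVandermondeValue a b c = fact (a + b) *ℚ invFact (+ a) *ℚ invFact (+ b) *ℚ binomOverFact (a + b) c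

chuVandermondeTerm-pascal : ∀ a b c i →
  chuVandermondeTerm a b (c -ℤ + 1) i +ℚ chuVandermondeTerm a b c i ≡ ι (+ suc a) *ℚ chuVandermondeTerm (suc a) b c i
chuVandermondeTerm-pascal a b c i = begin
  binomOverFact b i *ℚ binomOverFact a (c -ℤ + 1 -ℤ i) +ℚ binomOverFact b i *ℚ binomOverFact a (c -ℤ i)
    ≡⟨ cong (λ x → binomOverFact b i *ℚ binomOverFact a x +ℚ binomOverFact b i *ℚ binomOverFact a (c -ℤ i)) (swap c i) ⟩
  binomOverFact b i *ℚ binomOverFact a (c -ℤ i -ℤ + 1) +ℚ binomOverFact b i *ℚ binomOverFact a (c -ℤ i)
    ≡⟨ sym (ℚP.*-distribˡ-+ (binomOverFact b i) _ _) ⟩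
  binomOverFact b i *ℚ (binomOverFact a (c -ℤ i -ℤ + 1) +ℚ binomOverFact a (c -ℤ i))
    ≡⟨ cong (binomOverFact b i *ℚ_) (binomOverFact-pascal a (c -ℤ i)) ⟩
  binomOverFact b i *ℚ (ι (+ suc a) *ℚ binomOverFact (suc a) (c -ℤ i))
    ≡⟨ solve 3 (λ p x q → p :* (x :* q) := x :* (p :* q)) refl (binomOverFact b i) (ι (+ suc a)) (binomOverFact (suc a) (c -ℤ i)) ⟩
  ι (+ suc a) *ℚ (binomOverFact b i *ℚ binomOverFact (suc a) (c -ℤ i)) ∎
  where
  open ≡-Reasoning
  swap : ∀ c i → c -ℤ + 1 -ℤ i ≡ c -ℤ i -ℤ + 1
  swap = ℤRing.solve-∀

chuVandermondeValue-pascal : ∀ a b c →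
  chuVandermondeValue a b (c -ℤ + 1) +ℚ chuVandermondeValue a b c ≡ ι (+ suc a) *ℚ chuVandermondeValue (suc a) b c
chuVandermondeValue-pascal a b c = begin
  w *ℚ binomOverFact (a + b) (c -ℤ + 1) +ℚ w *ℚ binomOverFact (a + b) c
    ≡⟨ sym (ℚP.*-distribˡ-+ w _ _) ⟩
  w *ℚ (binomOverFact (a + b) (c -ℤ + 1) +ℚ binomOverFact (a + b) c)
    ≡⟨ cong (w *ℚ_) (binomOverFact-pascal (a + b) c) ⟩
  fact (a + b) *ℚ invFact (+ a) *ℚ invFact (+ b) *ℚ (ι (+ suc (a + b)) *ℚ binomOverFact (suc (a + b)) c)
    ≡⟨ cong (λ z → fact (a + b) *ℚ z *ℚ invFact (+ b) *ℚ (ι (+ suc (a + b)) *ℚ binomOverFact (suc (a + b)) c)) (invFact-suc (+ a)) ⟩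
  fact (a + b) *ℚ (ι (+ suc a) *ℚ invFact (+ suc a)) *ℚ invFact (+ b) *ℚ (ι (+ suc (a + b)) *ℚ binomOverFact (suc (a + b)) c)
    ≡⟨ solve 6 (λ f x i j y p → f :* (x :* i) :* j :* (y :* p) := x :* ((y :* f) :* i :* j :* p)) refl
         (fact (a + b)) (ι (+ suc a)) (invFact (+ suc a)) (invFact (+ b)) (ι (+ suc (a + b))) (binomOverFact (suc (a + b)) c) ⟩
  ι (+ suc a) *ℚ (ι (+ suc (a + b)) *ℚ fact (a + b) *ℚ invFact (+ suc a) *ℚ invFact (+ b) *ℚ binomOverFact (suc (a + b)) c)
    ≡⟨ cong (λ f → ι (+ suc a) *ℚ (f *ℚ invFact (+ suc a) *ℚ invFact (+ b) *ℚ binomOverFact (suc (a + b)) c)) (sym (fact-suc (a + b))) ⟩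
  ι (+ suc a) *ℚ chuVandermondeValue (suc a) b c ∎
  where
  open ≡-Reasoning
  w = fact (a + b) *ℚ invFact (+ a) *ℚ invFact (+ b)

chuVandermonde : ∀ a b c → HasSum (chuVandermondeTerm a b c) (chuVandermondeValue a b c)
chuVandermonde zero b c = subst (HasSum (chuVandermondeTerm 0 b c)) at-c (HasSum-point c off-c)
  where
  off-c : ∀ i → i ≢ c → chuVandermondeTerm 0 b c i ≡ 0ℚ
  off-c i i≢c = trans (cong (binomOverFact b i *ℚ_) (binomOverFact-zero (c -ℤ i) (λ c-i≡0 → i≢c (sym (ℤP.i-j≡0⇒i≡j c i c-i≡0)))))
                      (ℚP.*-zeroʳ (binomOverFact b i))
  at-c : chuVandermondeTerm 0 b c c ≡ chuVandermondeValue 0 b c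
  at-c = begin
    binomOverFact b c *ℚ binomOverFact 0 (c -ℤ c)   ≡⟨ cong (λ x → binomOverFact b c *ℚ binomOverFact 0 x) (ℤP.+-inverseʳ c) ⟩
    binomOverFact b c *ℚ 1ℚ                         ≡⟨ ℚP.*-identityʳ _ ⟩
    binomOverFact b c                               ≡⟨ sym (ℚP.*-identityˡ _) ⟩
    1ℚ *ℚ binomOverFact b c                         ≡⟨ cong (_*ℚ binomOverFact b c) (sym (trans (cong (_*ℚ invFact (+ b)) (ℚP.*-identityʳ (fact b))) (fact*invFact b))) ⟩
    fact b *ℚ 1ℚ *ℚ invFact (+ b) *ℚ binomOverFact b c ∎
    where open ≡-Reasoning
chuVandermonde (suc a) b c =
  HasSum-cancelˡ (fact a *ℚ invFact (+ suc a)) (ι (+ suc a)) (fact*invFact-suc a)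
    (subst (HasSum _) (chuVandermondeValue-pascal a b c)
      (HasSum-cong (chuVandermondeTerm-pascal a b c)
        (HasSum-+ (chuVandermonde a b (c -ℤ + 1)) (chuVandermonde a b c))))

vandermondeTerm : ℤ → ℤ → ℤ → ℤ → ℚ
vandermondeTerm b c d i = invFact i *ℚ invFact (b -ℤ i) *ℚ (invFact (c -ℤ i) *ℚ invFact (d +ℤ i))

vandermondeValue : ℤ → ℤ → ℤ → ℚ
vandermondeValue b c d = factℤ (b +ℤ c +ℤ d) *ℚ invFact b *ℚ invFact c *ℚ (invFact (c +ℤ d) *ℚ invFact (b +ℤ d))

vandermonde-nonneg : ∀ a b c d → + a ≡ c +ℤ d → HasSum (vandermondeTerm (+ b) c d) (vandermondeValue (+ b) c d)
vandermonde-nonneg a b c d a≡ = HasSum-cong term≡ (subst (HasSum _) value≡ (chuVandermonde a b c))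
  where
  term≡ : ∀ i → chuVandermondeTerm a b c i ≡ vandermondeTerm (+ b) c d i
  term≡ i = cong (λ x → invFact i *ℚ invFact (+ b -ℤ i) *ℚ (invFact (c -ℤ i) *ℚ invFact x))
                 (trans (cong (_-ℤ (c -ℤ i)) a≡) (e c d i))
    where
    e : ∀ c d i → c +ℤ d -ℤ (c -ℤ i) ≡ d +ℤ i
    e = ℤRing.solve-∀
  value≡ : chuVandermondeValue a b c ≡ vandermondeValue (+ b) c d
  value≡ = begin
    fact (a + b) *ℚ invFact (+ a) *ℚ invFact (+ b) *ℚ (invFact c *ℚ invFact (+ (a + b) -ℤ c))
      ≡⟨ cong₂ (λ x y → factℤ x *ℚ invFact (+ a) *ℚ invFact (+ b) *ℚ (invFact c *ℚ invFact (y -ℤ c))) a+b≡ a+b≡ ⟩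
    factℤ (+ b +ℤ c +ℤ d) *ℚ invFact (+ a) *ℚ invFact (+ b) *ℚ (invFact c *ℚ invFact (+ b +ℤ c +ℤ d -ℤ c))
      ≡⟨ cong₂ (λ x y → factℤ (+ b +ℤ c +ℤ d) *ℚ invFact x *ℚ invFact (+ b) *ℚ (invFact c *ℚ invFact y)) a≡ (e (+ b) c d) ⟩
    factℤ (+ b +ℤ c +ℤ d) *ℚ invFact (c +ℤ d) *ℚ invFact (+ b) *ℚ (invFact c *ℚ invFact (+ b +ℤ d))
      ≡⟨ solve 5 (λ f x y z w → f :* x :* y :* (z :* w) := f :* y :* z :* (x :* w)) refl
           (factℤ (+ b +ℤ c +ℤ d)) (invFact (c +ℤ d)) (invFact (+ b)) (invFact c) (invFact (+ b +ℤ d)) ⟩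
    vandermondeValue (+ b) c d ∎
    where
    open ≡-Reasoning
    e : ∀ b c d → b +ℤ c +ℤ d -ℤ c ≡ b +ℤ d
    e = ℤRing.solve-∀
    a+b≡ : + (a + b) ≡ + b +ℤ c +ℤ d
    a+b≡ = trans (ℤP.pos-+ a b) (trans (cong (_+ℤ + b) a≡) (swap (+ b) c d))
      where
      swap : ∀ b c d → c +ℤ d +ℤ b ≡ b +ℤ c +ℤ d
      swap = ℤRing.solve-∀

vandermonde : ∀ b c d → HasSum (vandermondeTerm b c d) (vandermondeValue b c d)
vandermonde b@(-[1+ _ ]) c d = subst (HasSum _) (sym value≡0) (HasSum-zero term≡0)
  where
  i+[b-i] : ∀ b i → i +ℤ (b -ℤ i) ≡ b
  i+[b-i] = ℤRing.solve-∀
  term≡0 : ∀ i → vandermondeTerm b c d i ≡ 0ℚ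
  term≡0 i = trans (cong (_*ℚ (invFact (c -ℤ i) *ℚ invFact (d +ℤ i)))
                         (invFact*invFact-neg i (b -ℤ i) (subst (ℤ._< + 0) (sym (i+[b-i] b i)) ℤ.-<+)))
                   (ℚP.*-zeroˡ (invFact (c -ℤ i) *ℚ invFact (d +ℤ i)))
  value≡0 : vandermondeValue b c d ≡ 0ℚ
  value≡0 = solve 4 (λ f y u v → f :* con 0ℚ :* y :* (u :* v) := con 0ℚ) refl
              (factℤ (b +ℤ c +ℤ d)) (invFact c) (invFact (c +ℤ d)) (invFact (b +ℤ d))
vandermonde (+ b) c d = split (c +ℤ d) refl
  where
  split : ∀ x → c +ℤ d ≡ x → HasSum (vandermondeTerm (+ b) c d) (vandermondeValue (+ b) c d)
  split -[1+ n ] c+d≡ = subst (HasSum _) (sym value≡0) (HasSum-zero term≡0)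
    where
    [c-i]+[d+i] : ∀ c d i → (c -ℤ i) +ℤ (d +ℤ i) ≡ c +ℤ d
    [c-i]+[d+i] = ℤRing.solve-∀
    term≡0 : ∀ i → vandermondeTerm (+ b) c d i ≡ 0ℚ
    term≡0 i = trans (cong (invFact i *ℚ invFact (+ b -ℤ i) *ℚ_)
                           (invFact*invFact-neg (c -ℤ i) (d +ℤ i) (subst (ℤ._< + 0) (sym (trans ([c-i]+[d+i] c d i) c+d≡)) ℤ.-<+)))
                     (ℚP.*-zeroʳ (invFact i *ℚ invFact (+ b -ℤ i)))
    value≡0 : vandermondeValue (+ b) c d ≡ 0ℚ
    value≡0 = trans (cong (λ x → factℤ (+ b +ℤ c +ℤ d) *ℚ invFact (+ b) *ℚ invFact c *ℚ (invFact x *ℚ invFact (+ b +ℤ d))) c+d≡)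
                (solve 4 (λ f x y v → f :* x :* y :* (con 0ℚ :* v) := con 0ℚ) refl
                   (factℤ (+ b +ℤ c +ℤ d)) (invFact (+ b)) (invFact c) (invFact (+ b +ℤ d)))
  split (+ a) c+d≡ = vandermonde-nonneg a b c d (sym c+d≡)

vandermondeTerm-vanishes : ∀ b c d W → c ℤ.≤ + W → VanishesOutside W (vandermondeTerm b c d)
vandermondeTerm-vanishes b c d W c≤W (+ n) W<n =
  trans (cong (λ z → invFact (+ n) *ℚ invFact (b -ℤ + n) *ℚ (z *ℚ invFact (d +ℤ + n)))
              (invFact-neg (i<j⇒i-j<0 (ℤP.≤-<-trans c≤W (ℤ.+<+ W<n)))))
        (solve 3 (λ x y z → x :* y :* (con 0ℚ :* z) := con 0ℚ) refl (invFact (+ n)) (invFact (b -ℤ + n)) (invFact (d +ℤ + n)))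
vandermondeTerm-vanishes b c d W c≤W -[1+ n ] _ =
  solve 3 (λ x y z → con 0ℚ :* x :* (y :* z) := con 0ℚ) refl
    (invFact (b -ℤ -[1+ n ])) (invFact (c -ℤ -[1+ n ])) (invFact (d +ℤ -[1+ n ]))

vandermondeTerm-vanishes₂ : ∀ b c d W → b +ℤ c ℤ.≤ + W +ℤ + W → VanishesOutside W (vandermondeTerm b c d)
vandermondeTerm-vanishes₂ b c d W b+c≤2W (+ n) W<n = begin
  invFact (+ n) *ℚ invFact (b -ℤ + n) *ℚ (invFact (c -ℤ + n) *ℚ invFact (d +ℤ + n))
    ≡⟨ solve 4 (λ x y z w → x :* y :* (z :* w) := x :* (y :* z) :* w) refl
         (invFact (+ n)) (invFact (b -ℤ + n)) (invFact (c -ℤ + n)) (invFact (d +ℤ + n)) ⟩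
  invFact (+ n) *ℚ (invFact (b -ℤ + n) *ℚ invFact (c -ℤ + n)) *ℚ invFact (d +ℤ + n)
    ≡⟨ cong (λ z → invFact (+ n) *ℚ z *ℚ invFact (d +ℤ + n)) (invFact*invFact-neg (b -ℤ + n) (c -ℤ + n) sum<0) ⟩
  invFact (+ n) *ℚ 0ℚ *ℚ invFact (d +ℤ + n)
    ≡⟨ solve 2 (λ x w → x :* con 0ℚ :* w := con 0ℚ) refl (invFact (+ n)) (invFact (d +ℤ + n)) ⟩
  0ℚ ∎
  where
  open ≡-Reasoning
  e : ∀ b c n → (b +ℤ c) -ℤ (n +ℤ n) ≡ (b -ℤ n) +ℤ (c -ℤ n)
  e = ℤRing.solve-∀
  sum<0 : (b -ℤ + n) +ℤ (c -ℤ + n) ℤ.< + 0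
  sum<0 = subst (ℤ._< + 0) (e b c (+ n)) (i<j⇒i-j<0 (ℤP.≤-<-trans b+c≤2W (ℤP.+-mono-< (ℤ.+<+ W<n) (ℤ.+<+ W<n))))
vandermondeTerm-vanishes₂ b c d W _ -[1+ n ] _ =
  solve 3 (λ x y z → con 0ℚ :* x :* (y :* z) := con 0ℚ) refl
    (invFact (b -ℤ -[1+ n ])) (invFact (c -ℤ -[1+ n ])) (invFact (d +ℤ -[1+ n ]))

-- An alternating sum of inverse factorials

neg-involutive : ∀ x → -ℚ (-ℚ x) ≡ x
neg-involutive = solve 1 (λ x → :- (:- x) := x) refl

sign-suc : ∀ k → sign (+ 1 +ℤ k) ≡ -ℚ sign k
sign-suc (+ n)    = refl
sign-suc -[1+ n ] = trans (cong sign (1-[1+m] (+ n))) (trans (sign-neg n) (sym (neg-involutive (sign (+ n)))))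
  where
  1-[1+m] : ∀ m → + 1 +ℤ -ℤ (+ 1 +ℤ m) ≡ -ℤ m
  1-[1+m] = ℤRing.solve-∀
  sign-neg : ∀ n → sign (-ℤ + n) ≡ sign (+ n)
  sign-neg zero    = refl
  sign-neg (suc n) = refl

sign-pred : ∀ k → sign (-[1+ 0 ] +ℤ k) ≡ -ℚ sign k
sign-pred k = begin
  sign (-[1+ 0 ] +ℤ k)                      ≡⟨ sym (neg-involutive _) ⟩
  -ℚ (-ℚ sign (-[1+ 0 ] +ℤ k))              ≡⟨ cong -ℚ_ (sym (sign-suc (-[1+ 0 ] +ℤ k))) ⟩
  -ℚ sign (+ 1 +ℤ (-[1+ 0 ] +ℤ k))          ≡⟨ cong (λ x → -ℚ sign x) (cancel k) ⟩
  -ℚ sign k                                 ∎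
  where
  open ≡-Reasoning
  cancel : ∀ k → + 1 +ℤ (-[1+ 0 ] +ℤ k) ≡ k
  cancel = ℤRing.solve-∀

invFact± : ℤ → ℤ → ℚ
invFact± i k = invFact (i +ℤ k) *ℚ invFact (i -ℤ k)

invFact±-vanishes : ∀ a → VanishesOutside a (invFact± (+ a))
invFact±-vanishes a (+ n) a<n =
  trans (cong (invFact (+ a +ℤ + n) *ℚ_) (invFact-neg (i<j⇒i-j<0 (ℤ.+<+ a<n)))) (ℚP.*-zeroʳ (invFact (+ a +ℤ + n)))
invFact±-vanishes a -[1+ n ] a<n =
  trans (cong (_*ℚ invFact (+ a -ℤ -[1+ n ])) (invFact-neg (m<n⇒m⊖n<0 a<n))) (ℚP.*-zeroˡ (invFact (+ a -ℤ -[1+ n ])))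

invFact±-neg : ∀ n k → invFact± -[1+ n ] k ≡ 0ℚ
invFact±-neg n k = invFact*invFact-neg (-[1+ n ] +ℤ k) (-[1+ n ] -ℤ k) (subst (ℤ._< + 0) (e -[1+ n ] k) ℤ.-<+)
  where
  e : ∀ x k → x +ℤ x ≡ (x +ℤ k) +ℤ (x -ℤ k)
  e = ℤRing.solve-∀

binom-central : ∀ u k → binom (2 * u) (+ u +ℤ k) ≡ fact (2 * u) *ℚ invFact± (+ u) k
binom-central u k = begin
  binom (2 * u) (+ u +ℤ k)                                          ≡⟨ binom-invFact (2 * u) (+ u +ℤ k) ⟩
  fact (2 * u) *ℚ invFact (+ u +ℤ k) *ℚ invFact (+ (2 * u) -ℤ (+ u +ℤ k)) ≡⟨ cong (λ x → fact (2 * u) *ℚ invFact (+ u +ℤ k) *ℚ invFact x) 2u-[u+k] ⟩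
  fact (2 * u) *ℚ invFact (+ u +ℤ k) *ℚ invFact (+ u -ℤ k)          ≡⟨ ℚP.*-assoc (fact (2 * u)) _ _ ⟩
  fact (2 * u) *ℚ invFact± (+ u) k                                  ∎
  where
  open ≡-Reasoning
  e : ∀ u k → (u +ℤ u) -ℤ (u +ℤ k) ≡ u -ℤ k
  e = ℤRing.solve-∀
  2u-[u+k] : + (2 * u) -ℤ (+ u +ℤ k) ≡ + u -ℤ k
  2u-[u+k] = trans (cong (λ z → + (u + z) -ℤ (+ u +ℤ k)) (ℕP.+-identityʳ u)) (e (+ u) k)

2ℚ : ℚ
2ℚ = 1ℚ +ℚ 1ℚ

stepCoeff : ℕ → ℚ
stepCoeff a = (ι (+ a) +ℚ ι (+ a) +ℚ 2ℚ) *ℚ (ι (+ a) +ℚ ι (+ a) +ℚ 1ℚ)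

invFact±-recurrence : ∀ a k →
  stepCoeff a *ℚ invFact± (+ suc a) k ≡ invFact± (+ a) (-[1+ 0 ] +ℤ k) +ℚ (2ℚ *ℚ invFact± (+ a) k +ℚ invFact± (+ a) (+ 1 +ℤ k))
invFact±-recurrence a k = begin
  stepCoeff a *ℚ (u *ℚ v)
    ≡⟨ solve 4 (λ α κ u v → (α :+ α :+ con 2ℚ) :* (α :+ α :+ con 1ℚ) :* (u :* v) :=
                 (α :+ κ) :* ((con 1ℚ :+ α :+ κ) :* u) :* v
                 :+ (con 2ℚ :* ((con 1ℚ :+ α :+ κ) :* u :* ((con 1ℚ :+ α :+ :- κ) :* v))
                 :+ u :* ((α :+ :- κ) :* ((con 1ℚ :+ α :+ :- κ) :* v))))
         refl (ι (+ a)) (ι k) u v ⟩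
  (ι (+ a) +ℚ ι k) *ℚ ((1ℚ +ℚ ι (+ a) +ℚ ι k) *ℚ u) *ℚ v
    +ℚ (2ℚ *ℚ ((1ℚ +ℚ ι (+ a) +ℚ ι k) *ℚ u *ℚ ((1ℚ +ℚ ι (+ a) +ℚ -ℚ ι k) *ℚ v))
    +ℚ u *ℚ ((ι (+ a) +ℚ -ℚ ι k) *ℚ ((1ℚ +ℚ ι (+ a) +ℚ -ℚ ι k) *ℚ v)))
    ≡⟨ sym (cong₂ (λ x y → (ι (+ a) +ℚ ι k) *ℚ ((1ℚ +ℚ ι (+ a) +ℚ ι k) *ℚ u) *ℚ v
                             +ℚ (2ℚ *ℚ ((1ℚ +ℚ ι (+ a) +ℚ ι k) *ℚ u *ℚ (y *ℚ v)) +ℚ u *ℚ (x *ℚ (y *ℚ v))))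
                  (ι-- (+ a) k) ιY) ⟩
  (ι (+ a) +ℚ ι k) *ℚ ((1ℚ +ℚ ι (+ a) +ℚ ι k) *ℚ u) *ℚ v
    +ℚ (2ℚ *ℚ ((1ℚ +ℚ ι (+ a) +ℚ ι k) *ℚ u *ℚ (ι Y *ℚ v)) +ℚ u *ℚ (ι (+ a -ℤ k) *ℚ (ι Y *ℚ v)))
    ≡⟨ sym (cong₂ (λ x y → x *ℚ (y *ℚ u) *ℚ v +ℚ (2ℚ *ℚ (y *ℚ u *ℚ (ι Y *ℚ v)) +ℚ u *ℚ (ι (+ a -ℤ k) *ℚ (ι Y *ℚ v))))
                  (ι-+ (+ a) k) ιX) ⟩
  ι (+ a +ℤ k) *ℚ (ι X *ℚ u) *ℚ v +ℚ (2ℚ *ℚ (ι X *ℚ u *ℚ (ι Y *ℚ v)) +ℚ u *ℚ (ι (+ a -ℤ k) *ℚ (ι Y *ℚ v)))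
    ≡⟨ sym (cong₂ _+ℚ_ (cong₂ _*ℚ_ lowerX₂ atY)
                       (cong₂ _+ℚ_ (cong (2ℚ *ℚ_) (cong₂ _*ℚ_ lowerX lowerY)) (cong₂ _*ℚ_ atX lowerY₂))) ⟩
  invFact± (+ a) (-[1+ 0 ] +ℤ k) +ℚ (2ℚ *ℚ invFact± (+ a) k +ℚ invFact± (+ a) (+ 1 +ℤ k)) ∎
  where
  open ≡-Reasoning
  X = + suc a +ℤ k
  Y = + suc a -ℤ k
  u = invFact X
  v = invFact Y
  pred-at : ∀ x y → x ≡ y -ℤ + 1 → invFact x ≡ ι y *ℚ invFact y
  pred-at x y x≡y-1 = trans (cong invFact x≡y-1) (invFact-pred y)
  ιX : ι X ≡ 1ℚ +ℚ ι (+ a) +ℚ ι k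
  ιX = trans (ι-+ (+ suc a) k) (cong (_+ℚ ι k) (ι-suc a))
  ιY : ι Y ≡ 1ℚ +ℚ ι (+ a) +ℚ -ℚ ι k
  ιY = trans (ι-- (+ suc a) k) (cong (_+ℚ -ℚ ι k) (ι-suc a))
  e₁ : ∀ a k → a +ℤ (-[1+ 0 ] +ℤ k) ≡ a +ℤ k -ℤ + 1
  e₁ = ℤRing.solve-∀
  e₂ : ∀ a k → a +ℤ k ≡ + 1 +ℤ a +ℤ k -ℤ + 1
  e₂ = ℤRing.solve-∀
  e₃ : ∀ a k → a -ℤ (-[1+ 0 ] +ℤ k) ≡ + 1 +ℤ a -ℤ k
  e₃ = ℤRing.solve-∀
  e₄ : ∀ a k → a -ℤ k ≡ + 1 +ℤ a -ℤ k -ℤ + 1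
  e₄ = ℤRing.solve-∀
  e₅ : ∀ a k → a +ℤ (+ 1 +ℤ k) ≡ + 1 +ℤ a +ℤ k
  e₅ = ℤRing.solve-∀
  e₆ : ∀ a k → a -ℤ (+ 1 +ℤ k) ≡ a -ℤ k -ℤ + 1
  e₆ = ℤRing.solve-∀
  lowerX : invFact (+ a +ℤ k) ≡ ι X *ℚ u
  lowerX = pred-at _ X (e₂ (+ a) k)
  lowerY : invFact (+ a -ℤ k) ≡ ι Y *ℚ v
  lowerY = pred-at _ Y (e₄ (+ a) k)
  lowerX₂ : invFact (+ a +ℤ (-[1+ 0 ] +ℤ k)) ≡ ι (+ a +ℤ k) *ℚ (ι X *ℚ u)
  lowerX₂ = trans (pred-at _ (+ a +ℤ k) (e₁ (+ a) k)) (cong (ι (+ a +ℤ k) *ℚ_) lowerX)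
  lowerY₂ : invFact (+ a -ℤ (+ 1 +ℤ k)) ≡ ι (+ a -ℤ k) *ℚ (ι Y *ℚ v)
  lowerY₂ = trans (pred-at _ (+ a -ℤ k) (e₆ (+ a) k)) (cong (ι (+ a -ℤ k) *ℚ_) lowerY)
  atX : invFact (+ a +ℤ (+ 1 +ℤ k)) ≡ u
  atX = cong invFact (e₅ (+ a) k)
  atY : invFact (+ a -ℤ (-[1+ 0 ] +ℤ k)) ≡ v
  atY = cong invFact (e₃ (+ a) k)

stepCoeff⁻¹ : ℕ → ℚ
stepCoeff⁻¹ a = fact (2 * a) *ℚ invFact (+ suc (suc (2 * a)))

stepCoeff⁻¹*stepCoeff : ∀ a → stepCoeff⁻¹ a *ℚ stepCoeff a ≡ 1ℚ
stepCoeff⁻¹*stepCoeff a = begin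
  fact (2 * a) *ℚ invFact x₂ *ℚ stepCoeff a  ≡⟨ cong (fact (2 * a) *ℚ invFact x₂ *ℚ_) stepCoeff≡ ⟩
  fact (2 * a) *ℚ invFact x₂ *ℚ (ι x₂ *ℚ ι x₁)
    ≡⟨ solve 4 (λ f i a b → f :* i :* (a :* b) := f :* (b :* (a :* i))) refl (fact (2 * a)) (invFact x₂) (ι x₂) (ι x₁) ⟩
  fact (2 * a) *ℚ (ι x₁ *ℚ (ι x₂ *ℚ invFact x₂)) ≡⟨ cong (λ z → fact (2 * a) *ℚ (ι x₁ *ℚ z)) (sym (invFact-suc x₁)) ⟩
  fact (2 * a) *ℚ (ι x₁ *ℚ invFact x₁)          ≡⟨ cong (fact (2 * a) *ℚ_) (sym (invFact-suc (+ (2 * a)))) ⟩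
  fact (2 * a) *ℚ invFact (+ (2 * a))           ≡⟨ fact*invFact (2 * a) ⟩
  1ℚ                                            ∎
  where
  open ≡-Reasoning
  x₁ = + suc (2 * a)
  x₂ = + suc (suc (2 * a))
  ι2a : ι (+ (2 * a)) ≡ ι (+ a) +ℚ ι (+ a)
  ι2a = trans (cong ι (ℤP.pos-+ a (a + 0))) (trans (ι-+ (+ a) (+ (a + 0))) (cong (λ z → ι (+ a) +ℚ ι (+ z)) (ℕP.+-identityʳ a)))
  ιx₁ : ι x₁ ≡ 1ℚ +ℚ (ι (+ a) +ℚ ι (+ a))
  ιx₁ = trans (ι-suc (2 * a)) (cong (1ℚ +ℚ_) ι2a)
  stepCoeff≡ : stepCoeff a ≡ ι x₂ *ℚ ι x₁
  stepCoeff≡ = begin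
    stepCoeff a
      ≡⟨ solve 1 (λ α → (α :+ α :+ con 2ℚ) :* (α :+ α :+ con 1ℚ) := (con 1ℚ :+ (con 1ℚ :+ (α :+ α))) :* (con 1ℚ :+ (α :+ α))) refl (ι (+ a)) ⟩
    (1ℚ +ℚ (1ℚ +ℚ (ι (+ a) +ℚ ι (+ a)))) *ℚ (1ℚ +ℚ (ι (+ a) +ℚ ι (+ a)))
      ≡⟨ sym (cong₂ _*ℚ_ (trans (ι-suc (suc (2 * a))) (cong (1ℚ +ℚ_) ιx₁)) ιx₁) ⟩
    ι x₂ *ℚ ι x₁ ∎

altTerm : ℤ → ℤ → ℤ → ℚ
altTerm i j k = sign k *ℚ (invFact± i k *ℚ invFact± j k)

altValue : ℤ → ℤ → ℚ
altValue i j = invFact i *ℚ invFact j *ℚ invFact (i +ℤ j)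

altTerm-vanishes : ∀ a j → VanishesOutside a (λ k → altTerm (+ a) j k)
altTerm-vanishes a j k a<k =
  trans (cong (λ z → sign k *ℚ (z *ℚ invFact± j k)) (invFact±-vanishes a k a<k))
        (solve 2 (λ s g → s :* (con 0ℚ :* g) := con 0ℚ) refl (sign k) (invFact± j k))

altSum-zero : ∀ b → HasSum (altTerm (+ 0) (+ b)) (altValue (+ 0) (+ b))
altSum-zero b = subst (HasSum _) at-0 (HasSum-point (+ 0) λ k k≢0 → altTerm-vanishes 0 (+ b) k (0<∣k∣ k k≢0))
  where
  0<∣k∣ : ∀ k → k ≢ + 0 → 0 ℕ.< ℤ.∣ k ∣
  0<∣k∣ (+ zero)  k≢0 = ⊥-elim (k≢0 refl)
  0<∣k∣ (+ suc _) _   = ℕ.s≤s ℕ.z≤n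
  0<∣k∣ -[1+ _ ]  _   = ℕ.s≤s ℕ.z≤n
  at-0 : altTerm (+ 0) (+ b) (+ 0) ≡ altValue (+ 0) (+ b)
  at-0 = trans (cong (λ z → 1ℚ *ℚ ((1ℚ *ℚ 1ℚ) *ℚ (invFact (+ z) *ℚ invFact (+ z)))) (ℕP.+-identityʳ b))
               (solve 1 (λ x → con 1ℚ :* ((con 1ℚ :* con 1ℚ) :* (x :* x)) := con 1ℚ :* x :* x) refl (invFact (+ b)))

altValue-recurrence : ∀ a b →
  2ℚ *ℚ altValue (+ a) (+ b) +ℚ 2ℚ *ℚ altValue (+ a) (+ b) +ℚ -ℚ (stepCoeff b *ℚ altValue (+ a) (+ suc b))
    ≡ stepCoeff a *ℚ altValue (+ suc a) (+ b)
altValue-recurrence a b = begin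
  2ℚ *ℚ altValue (+ a) (+ b) +ℚ 2ℚ *ℚ altValue (+ a) (+ b) +ℚ -ℚ (stepCoeff b *ℚ altValue (+ a) (+ suc b))
    ≡⟨ cong₂ (λ x y → 2ℚ *ℚ x +ℚ 2ℚ *ℚ x +ℚ -ℚ (stepCoeff b *ℚ y)) value-ab value-ab′ ⟩
  2ℚ *ℚ (α′ *ℚ β′ *ℚ (1ℚ +ℚ (α +ℚ β)) *ℚ P) +ℚ 2ℚ *ℚ (α′ *ℚ β′ *ℚ (1ℚ +ℚ (α +ℚ β)) *ℚ P) +ℚ -ℚ (stepCoeff b *ℚ (α′ *ℚ P))
    ≡⟨ solve 3 (λ α β P →
         con 2ℚ :* ((con 1ℚ :+ α) :* (con 1ℚ :+ β) :* (con 1ℚ :+ (α :+ β)) :* P)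
         :+ con 2ℚ :* ((con 1ℚ :+ α) :* (con 1ℚ :+ β) :* (con 1ℚ :+ (α :+ β)) :* P)
         :+ :- ((β :+ β :+ con 2ℚ) :* (β :+ β :+ con 1ℚ) :* ((con 1ℚ :+ α) :* P))
         := (α :+ α :+ con 2ℚ) :* (α :+ α :+ con 1ℚ) :* ((con 1ℚ :+ β) :* P))
         refl α β P ⟩
  stepCoeff a *ℚ (β′ *ℚ P)                     ≡⟨ cong (stepCoeff a *ℚ_) (sym value-a′b) ⟩
  stepCoeff a *ℚ altValue (+ suc a) (+ b)      ∎
  where
  open ≡-Reasoning
  α = ι (+ a)
  β = ι (+ b)
  α′ = 1ℚ +ℚ α
  β′ = 1ℚ +ℚ β
  P = invFact (+ suc a) *ℚ invFact (+ suc b) *ℚ invFact (+ suc (a + b))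
  ι[1+a+b] : ι (+ suc (a + b)) ≡ 1ℚ +ℚ (α +ℚ β)
  ι[1+a+b] = trans (ι-suc (a + b)) (cong (1ℚ +ℚ_) (trans (cong ι (ℤP.pos-+ a b)) (ι-+ (+ a) (+ b))))
  invFact-a : invFact (+ a) ≡ α′ *ℚ invFact (+ suc a)
  invFact-a = trans (invFact-suc (+ a)) (cong (_*ℚ invFact (+ suc a)) (ι-suc a))
  invFact-b : invFact (+ b) ≡ β′ *ℚ invFact (+ suc b)
  invFact-b = trans (invFact-suc (+ b)) (cong (_*ℚ invFact (+ suc b)) (ι-suc b))
  invFact-a+b : invFact (+ (a + b)) ≡ (1ℚ +ℚ (α +ℚ β)) *ℚ invFact (+ suc (a + b))
  invFact-a+b = trans (invFact-suc (+ (a + b))) (cong (_*ℚ invFact (+ suc (a + b))) ι[1+a+b])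
  value-ab : altValue (+ a) (+ b) ≡ α′ *ℚ β′ *ℚ (1ℚ +ℚ (α +ℚ β)) *ℚ P
  value-ab = trans (cong₂ (λ x y → x *ℚ y *ℚ invFact (+ (a + b))) invFact-a invFact-b)
    (trans (cong (α′ *ℚ invFact (+ suc a) *ℚ (β′ *ℚ invFact (+ suc b)) *ℚ_) invFact-a+b)
           (solve 6 (λ x u y v z w → x :* u :* (y :* v) :* (z :* w) := x :* y :* z :* (u :* v :* w)) refl
                    α′ (invFact (+ suc a)) β′ (invFact (+ suc b)) (1ℚ +ℚ (α +ℚ β)) (invFact (+ suc (a + b)))))
  value-ab′ : altValue (+ a) (+ suc b) ≡ α′ *ℚ P
  value-ab′ = trans (cong₂ (λ x y → x *ℚ invFact (+ suc b) *ℚ invFact (+ y)) invFact-a (ℕP.+-suc a b))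
    (solve 4 (λ x u v w → x :* u :* v :* w := x :* (u :* v :* w)) refl α′ (invFact (+ suc a)) (invFact (+ suc b)) (invFact (+ suc (a + b))))
  value-a′b : altValue (+ suc a) (+ b) ≡ β′ *ℚ P
  value-a′b = trans (cong (λ x → invFact (+ suc a) *ℚ x *ℚ invFact (+ suc (a + b))) invFact-b)
    (solve 4 (λ u y v w → u :* (y :* v) :* w := y :* (u :* v :* w)) refl (invFact (+ suc a)) β′ (invFact (+ suc b)) (invFact (+ suc (a + b))))

crossTerm : ℕ → ℕ → ℤ → ℤ → ℚ
crossTerm a b d k = sign k *ℚ (invFact± (+ a) k *ℚ invFact± (+ b) (d +ℤ k))

crossTerm-vanishes : ∀ a b d → VanishesOutside a (crossTerm a b d)
crossTerm-vanishes a b d k a<k =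
  trans (cong (λ z → sign k *ℚ (z *ℚ invFact± (+ b) (d +ℤ k))) (invFact±-vanishes a k a<k))
        (solve 2 (λ s g → s :* (con 0ℚ :* g) := con 0ℚ) refl (sign k) (invFact± (+ b) (d +ℤ k)))

crossTerm-recurrence : ∀ a b k →
  stepCoeff b *ℚ altTerm (+ a) (+ suc b) k +ℚ (-ℚ 2ℚ) *ℚ altTerm (+ a) (+ b) k ≡ crossTerm a b -[1+ 0 ] k +ℚ crossTerm a b (+ 1) k
crossTerm-recurrence a b k = begin
  stepCoeff b *ℚ (sign k *ℚ (Gᵃ k *ℚ invFact± (+ suc b) k)) +ℚ (-ℚ 2ℚ) *ℚ (sign k *ℚ (Gᵃ k *ℚ Gᵇ k))
    ≡⟨ solve 5 (λ c s x y z → c :* (s :* (x :* y)) :+ (:- con 2ℚ) :* (s :* (x :* z)) := s :* x :* (c :* y) :+ (:- con 2ℚ) :* (s :* (x :* z)))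
         refl (stepCoeff b) (sign k) (Gᵃ k) (invFact± (+ suc b) k) (Gᵇ k) ⟩
  sign k *ℚ Gᵃ k *ℚ (stepCoeff b *ℚ invFact± (+ suc b) k) +ℚ (-ℚ 2ℚ) *ℚ (sign k *ℚ (Gᵃ k *ℚ Gᵇ k))
    ≡⟨ cong (λ z → sign k *ℚ Gᵃ k *ℚ z +ℚ (-ℚ 2ℚ) *ℚ (sign k *ℚ (Gᵃ k *ℚ Gᵇ k))) (invFact±-recurrence b k) ⟩
  sign k *ℚ Gᵃ k *ℚ (Gᵇ (-[1+ 0 ] +ℤ k) +ℚ (2ℚ *ℚ Gᵇ k +ℚ Gᵇ (+ 1 +ℤ k))) +ℚ (-ℚ 2ℚ) *ℚ (sign k *ℚ (Gᵃ k *ℚ Gᵇ k))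
    ≡⟨ solve 5 (λ s x m z p → s :* x :* (m :+ (con 2ℚ :* z :+ p)) :+ (:- con 2ℚ) :* (s :* (x :* z)) := s :* (x :* m) :+ s :* (x :* p))
         refl (sign k) (Gᵃ k) (Gᵇ (-[1+ 0 ] +ℤ k)) (Gᵇ k) (Gᵇ (+ 1 +ℤ k)) ⟩
  crossTerm a b -[1+ 0 ] k +ℚ crossTerm a b (+ 1) k ∎
  where
  open ≡-Reasoning
  Gᵃ = invFact± (+ a)
  Gᵇ = invFact± (+ b)

altTerm-recurrence : ∀ a b k →
  (-ℚ 1ℚ) *ℚ crossTerm a b (+ 1) (-[1+ 0 ] +ℤ k) +ℚ 2ℚ *ℚ altTerm (+ a) (+ b) k +ℚ (-ℚ 1ℚ) *ℚ crossTerm a b -[1+ 0 ] (+ 1 +ℤ k)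
    ≡ stepCoeff a *ℚ altTerm (+ suc a) (+ b) k
altTerm-recurrence a b k = begin
  (-ℚ 1ℚ) *ℚ (sign (-[1+ 0 ] +ℤ k) *ℚ (Gᵃ (-[1+ 0 ] +ℤ k) *ℚ Gᵇ (+ 1 +ℤ (-[1+ 0 ] +ℤ k))))
    +ℚ 2ℚ *ℚ (sign k *ℚ (Gᵃ k *ℚ Gᵇ k))
    +ℚ (-ℚ 1ℚ) *ℚ (sign (+ 1 +ℤ k) *ℚ (Gᵃ (+ 1 +ℤ k) *ℚ Gᵇ (-[1+ 0 ] +ℤ (+ 1 +ℤ k))))
    ≡⟨ cong₂ (λ x y → (-ℚ 1ℚ) *ℚ (x *ℚ (Gᵃ (-[1+ 0 ] +ℤ k) *ℚ Gᵇ (+ 1 +ℤ (-[1+ 0 ] +ℤ k))))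
                      +ℚ 2ℚ *ℚ (sign k *ℚ (Gᵃ k *ℚ Gᵇ k))
                      +ℚ (-ℚ 1ℚ) *ℚ (y *ℚ (Gᵃ (+ 1 +ℤ k) *ℚ Gᵇ (-[1+ 0 ] +ℤ (+ 1 +ℤ k)))))
             (sign-pred k) (sign-suc k) ⟩
  (-ℚ 1ℚ) *ℚ (-ℚ sign k *ℚ (Gᵃ (-[1+ 0 ] +ℤ k) *ℚ Gᵇ (+ 1 +ℤ (-[1+ 0 ] +ℤ k))))
    +ℚ 2ℚ *ℚ (sign k *ℚ (Gᵃ k *ℚ Gᵇ k))
    +ℚ (-ℚ 1ℚ) *ℚ (-ℚ sign k *ℚ (Gᵃ (+ 1 +ℤ k) *ℚ Gᵇ (-[1+ 0 ] +ℤ (+ 1 +ℤ k))))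
    ≡⟨ cong₂ (λ x y → (-ℚ 1ℚ) *ℚ (-ℚ sign k *ℚ (Gᵃ (-[1+ 0 ] +ℤ k) *ℚ Gᵇ x))
                      +ℚ 2ℚ *ℚ (sign k *ℚ (Gᵃ k *ℚ Gᵇ k))
                      +ℚ (-ℚ 1ℚ) *ℚ (-ℚ sign k *ℚ (Gᵃ (+ 1 +ℤ k) *ℚ Gᵇ y)))
             (cancel₁ k) (cancel₂ k) ⟩
  (-ℚ 1ℚ) *ℚ (-ℚ sign k *ℚ (Gᵃ (-[1+ 0 ] +ℤ k) *ℚ Gᵇ k))
    +ℚ 2ℚ *ℚ (sign k *ℚ (Gᵃ k *ℚ Gᵇ k))
    +ℚ (-ℚ 1ℚ) *ℚ (-ℚ sign k *ℚ (Gᵃ (+ 1 +ℤ k) *ℚ Gᵇ k))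
    ≡⟨ solve 5 (λ s m z p y → (:- con 1ℚ) :* (:- s :* (m :* y)) :+ con 2ℚ :* (s :* (z :* y)) :+ (:- con 1ℚ) :* (:- s :* (p :* y))
                              := s :* y :* (m :+ (con 2ℚ :* z :+ p)))
         refl (sign k) (Gᵃ (-[1+ 0 ] +ℤ k)) (Gᵃ k) (Gᵃ (+ 1 +ℤ k)) (Gᵇ k) ⟩
  sign k *ℚ Gᵇ k *ℚ (Gᵃ (-[1+ 0 ] +ℤ k) +ℚ (2ℚ *ℚ Gᵃ k +ℚ Gᵃ (+ 1 +ℤ k)))
    ≡⟨ cong (sign k *ℚ Gᵇ k *ℚ_) (sym (invFact±-recurrence a k)) ⟩
  sign k *ℚ Gᵇ k *ℚ (stepCoeff a *ℚ invFact± (+ suc a) k)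
    ≡⟨ solve 4 (λ s y c x → s :* y :* (c :* x) := c :* (s :* (x :* y))) refl (sign k) (Gᵇ k) (stepCoeff a) (invFact± (+ suc a) k) ⟩
  stepCoeff a *ℚ altTerm (+ suc a) (+ b) k ∎
  where
  open ≡-Reasoning
  Gᵃ = invFact± (+ a)
  Gᵇ = invFact± (+ b)
  cancel₁ : ∀ k → + 1 +ℤ (-[1+ 0 ] +ℤ k) ≡ k
  cancel₁ = ℤRing.solve-∀
  cancel₂ : ∀ k → -[1+ 0 ] +ℤ (+ 1 +ℤ k) ≡ k
  cancel₂ = ℤRing.solve-∀

-- Multiplying by (2a+2)(2a+1) and using the recurrence for a, the sum for a+1
-- becomes the shifted cross sums S⁺, S⁻ plus twice the sum for a; the
-- recurrence for b expresses S⁻ + S⁺ through the sums for (a, b) and (a, b+1).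
altSum-step : ∀ a → (∀ b → HasSum (altTerm (+ a) (+ b)) (altValue (+ a) (+ b))) →
              ∀ b → HasSum (altTerm (+ suc a) (+ b)) (altValue (+ suc a) (+ b))
altSum-step a IH b =
  HasSum-cancelˡ (stepCoeff⁻¹ a) (stepCoeff a) (stepCoeff⁻¹*stepCoeff a)
    (subst (HasSum _) value≡ (HasSum-cong (altTerm-recurrence a b) shifted-sum))
  where
  R = altValue (+ a) (+ b)
  R′ = altValue (+ a) (+ suc b)
  S⁺ = sumℤ a (crossTerm a b (+ 1))
  S⁻ = sumℤ a (crossTerm a b -[1+ 0 ])
  S⁺-sum : HasSum (crossTerm a b (+ 1)) S⁺
  S⁺-sum = HasSum-window (crossTerm-vanishes a b (+ 1))
  S⁻-sum : HasSum (crossTerm a b -[1+ 0 ]) S⁻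
  S⁻-sum = HasSum-window (crossTerm-vanishes a b -[1+ 0 ])
  S⁻+S⁺ : S⁻ +ℚ S⁺ ≡ stepCoeff b *ℚ R′ +ℚ (-ℚ 2ℚ) *ℚ R
  S⁻+S⁺ = HasSum-unique (HasSum-+ S⁻-sum S⁺-sum)
    (HasSum-cong (crossTerm-recurrence a b) (HasSum-+ (HasSum-*ˡ (stepCoeff b) (IH (suc b))) (HasSum-*ˡ (-ℚ 2ℚ) (IH b))))
  shifted-sum : HasSum _ ((-ℚ 1ℚ) *ℚ S⁺ +ℚ 2ℚ *ℚ R +ℚ (-ℚ 1ℚ) *ℚ S⁻)
  shifted-sum = HasSum-+ (HasSum-+ (HasSum-*ˡ (-ℚ 1ℚ) (HasSum-shift -[1+ 0 ] S⁺-sum)) (HasSum-*ˡ 2ℚ (IH b)))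
                         (HasSum-*ˡ (-ℚ 1ℚ) (HasSum-shift (+ 1) S⁻-sum))
  value≡ : (-ℚ 1ℚ) *ℚ S⁺ +ℚ 2ℚ *ℚ R +ℚ (-ℚ 1ℚ) *ℚ S⁻ ≡ stepCoeff a *ℚ altValue (+ suc a) (+ b)
  value≡ = begin
    (-ℚ 1ℚ) *ℚ S⁺ +ℚ 2ℚ *ℚ R +ℚ (-ℚ 1ℚ) *ℚ S⁻
      ≡⟨ solve 3 (λ s⁺ s⁻ r → (:- con 1ℚ) :* s⁺ :+ con 2ℚ :* r :+ (:- con 1ℚ) :* s⁻ := con 2ℚ :* r :+ :- (s⁻ :+ s⁺)) refl S⁺ S⁻ R ⟩
    2ℚ *ℚ R +ℚ -ℚ (S⁻ +ℚ S⁺)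
      ≡⟨ cong (λ z → 2ℚ *ℚ R +ℚ -ℚ z) S⁻+S⁺ ⟩
    2ℚ *ℚ R +ℚ -ℚ (stepCoeff b *ℚ R′ +ℚ (-ℚ 2ℚ) *ℚ R)
      ≡⟨ solve 3 (λ r r′ c → con 2ℚ :* r :+ :- (c :* r′ :+ (:- con 2ℚ) :* r) := con 2ℚ :* r :+ con 2ℚ :* r :+ :- (c :* r′)) refl R R′ (stepCoeff b) ⟩
    2ℚ *ℚ R +ℚ 2ℚ *ℚ R +ℚ -ℚ (stepCoeff b *ℚ R′)
      ≡⟨ altValue-recurrence a b ⟩
    stepCoeff a *ℚ altValue (+ suc a) (+ b) ∎
    where open ≡-Reasoning

altSum-nonneg : ∀ a b → HasSum (altTerm (+ a) (+ b)) (altValue (+ a) (+ b))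
altSum-nonneg zero    = altSum-zero
altSum-nonneg (suc a) = altSum-step a (altSum-nonneg a)

altSum : ∀ i j → HasSum (altTerm i j) (altValue i j)
altSum (+ a)    (+ b)    = altSum-nonneg a b
altSum -[1+ n ] j        = subst (HasSum _) (sym (trans (cong (_*ℚ invFact (-[1+ n ] +ℤ j)) (ℚP.*-zeroˡ (invFact j)))
                                                            (ℚP.*-zeroˡ (invFact (-[1+ n ] +ℤ j)))))
  (HasSum-zero λ k → trans (cong (λ z → sign k *ℚ (z *ℚ invFact± j k)) (invFact±-neg n k))
                           (solve 2 (λ s g → s :* (con 0ℚ :* g) := con 0ℚ) refl (sign k) (invFact± j k)))
altSum (+ a)    -[1+ n ] = subst (HasSum _) (sym (trans (cong (_*ℚ invFact (+ a +ℤ -[1+ n ])) (ℚP.*-zeroʳ (invFact (+ a))))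
                                                            (ℚP.*-zeroˡ (invFact (+ a +ℤ -[1+ n ])))))
  (HasSum-zero λ k → trans (cong (λ z → sign k *ℚ (invFact± (+ a) k *ℚ z)) (invFact±-neg n k))
                           (solve 2 (λ s g → s :* (g :* con 0ℚ) := con 0ℚ) refl (sign k) (invFact± (+ a) k)))

-- Products of binomial coefficients

binom²Weight : ℕ → ℕ → ℤ → ℚ
binom²Weight M N j = fact (M + N) *ℚ invFact (+ M -ℤ j) *ℚ invFact (+ N -ℤ j)

binom²Term : ℕ → ℕ → ℤ → ℤ → ℚ
binom²Term M N k j = binom²Weight M N j *ℚ invFact± j k

vandermondeValue-binom² : ∀ M N k →
  fact (M + N) *ℚ vandermondeValue (+ M -ℤ k) (+ N -ℤ k) (k +ℤ k) ≡ binom (M + N) (+ M +ℤ k) *ℚ binom (M + N) (+ N +ℤ k)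
vandermondeValue-binom² M N k = begin
  fact (M + N) *ℚ (factℤ (b +ℤ c +ℤ d) *ℚ invFact b *ℚ invFact c *ℚ (invFact (c +ℤ d) *ℚ invFact (b +ℤ d)))
    ≡⟨ cong (λ u → fact (M + N) *ℚ (factℤ u *ℚ invFact b *ℚ invFact c *ℚ (invFact (c +ℤ d) *ℚ invFact (b +ℤ d)))) M+N≡ ⟩
  fact (M + N) *ℚ (fact (M + N) *ℚ invFact b *ℚ invFact c *ℚ (invFact (c +ℤ d) *ℚ invFact (b +ℤ d)))
    ≡⟨ cong₂ (λ v w → fact (M + N) *ℚ (fact (M + N) *ℚ invFact b *ℚ invFact c *ℚ (invFact v *ℚ invFact w)))
             (shift (+ N) k) (shift (+ M) k) ⟩
  fact (M + N) *ℚ (fact (M + N) *ℚ invFact b *ℚ invFact c *ℚ (invFact (+ N +ℤ k) *ℚ invFact (+ M +ℤ k)))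
    ≡⟨ solve 5 (λ f x y z w → f :* (f :* x :* y :* (z :* w)) := f :* w :* y :* (f :* z :* x)) refl
         (fact (M + N)) (invFact b) (invFact c) (invFact (+ N +ℤ k)) (invFact (+ M +ℤ k)) ⟩
  fact (M + N) *ℚ invFact (+ M +ℤ k) *ℚ invFact c *ℚ (fact (M + N) *ℚ invFact (+ N +ℤ k) *ℚ invFact b)
    ≡⟨ cong₂ (λ u v → fact (M + N) *ℚ invFact (+ M +ℤ k) *ℚ invFact u *ℚ (fact (M + N) *ℚ invFact (+ N +ℤ k) *ℚ invFact v))
             (complement (+ M) (+ N) k) (trans (complement (+ N) (+ M) k) (cong (_-ℤ (+ N +ℤ k)) (ℤP.+-comm (+ N) (+ M)))) ⟩
  fact (M + N) *ℚ invFact (+ M +ℤ k) *ℚ invFact (+ (M + N) -ℤ (+ M +ℤ k))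
    *ℚ (fact (M + N) *ℚ invFact (+ N +ℤ k) *ℚ invFact (+ (M + N) -ℤ (+ N +ℤ k)))
    ≡⟨ sym (cong₂ _*ℚ_ (binom-invFact (M + N) (+ M +ℤ k)) (binom-invFact (M + N) (+ N +ℤ k))) ⟩
  binom (M + N) (+ M +ℤ k) *ℚ binom (M + N) (+ N +ℤ k) ∎
  where
  open ≡-Reasoning
  b = + M -ℤ k
  c = + N -ℤ k
  d = k +ℤ k
  M+N≡ : b +ℤ c +ℤ d ≡ + (M + N)
  M+N≡ = trans (e (+ M) (+ N) k) (sym (ℤP.pos-+ M N))
    where
    e : ∀ m n k → (m -ℤ k) +ℤ (n -ℤ k) +ℤ (k +ℤ k) ≡ m +ℤ n
    e = ℤRing.solve-∀
  shift : ∀ m k → (m -ℤ k) +ℤ (k +ℤ k) ≡ m +ℤ k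
  shift = ℤRing.solve-∀
  complement : ∀ m n k → n -ℤ k ≡ (m +ℤ n) -ℤ (m +ℤ k)
  complement = ℤRing.solve-∀

binom²-expansion : ∀ M N k → HasSum (binom²Term M N k) (binom (M + N) (+ M +ℤ k) *ℚ binom (M + N) (+ N +ℤ k))
binom²-expansion M N k =
  subst (HasSum _) (vandermondeValue-binom² M N k) (HasSum-cong term≡ (HasSum-*ˡ (fact (M + N)) (HasSum-shift (-ℤ k) (vandermonde b c d))))
  where
  b = + M -ℤ k
  c = + N -ℤ k
  d = k +ℤ k
  e₁ : ∀ k j → -ℤ k +ℤ j ≡ j -ℤ k
  e₁ = ℤRing.solve-∀
  e₂ : ∀ m k j → (m -ℤ k) -ℤ (-ℤ k +ℤ j) ≡ m -ℤ j
  e₂ = ℤRing.solve-∀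
  e₃ : ∀ k j → (k +ℤ k) +ℤ (-ℤ k +ℤ j) ≡ j +ℤ k
  e₃ = ℤRing.solve-∀
  term≡ : ∀ j → fact (M + N) *ℚ vandermondeTerm b c d (-ℤ k +ℤ j) ≡ binom²Term M N k j
  term≡ j = begin
    fact (M + N) *ℚ (invFact (-ℤ k +ℤ j) *ℚ invFact (b -ℤ (-ℤ k +ℤ j)) *ℚ (invFact (c -ℤ (-ℤ k +ℤ j)) *ℚ invFact (d +ℤ (-ℤ k +ℤ j))))
      ≡⟨ cong₂ (λ u v → fact (M + N) *ℚ (invFact u *ℚ invFact v *ℚ (invFact (c -ℤ (-ℤ k +ℤ j)) *ℚ invFact (d +ℤ (-ℤ k +ℤ j)))))
               (e₁ k j) (e₂ (+ M) k j) ⟩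
    fact (M + N) *ℚ (invFact (j -ℤ k) *ℚ invFact (+ M -ℤ j) *ℚ (invFact (c -ℤ (-ℤ k +ℤ j)) *ℚ invFact (d +ℤ (-ℤ k +ℤ j))))
      ≡⟨ cong₂ (λ u v → fact (M + N) *ℚ (invFact (j -ℤ k) *ℚ invFact (+ M -ℤ j) *ℚ (invFact u *ℚ invFact v)))
               (e₂ (+ N) k j) (e₃ k j) ⟩
    fact (M + N) *ℚ (invFact (j -ℤ k) *ℚ invFact (+ M -ℤ j) *ℚ (invFact (+ N -ℤ j) *ℚ invFact (j +ℤ k)))
      ≡⟨ solve 5 (λ f a b c e → f :* (a :* b :* (c :* e)) := f :* b :* c :* (e :* a)) refl
           (fact (M + N)) (invFact (j -ℤ k)) (invFact (+ M -ℤ j)) (invFact (+ N -ℤ j)) (invFact (j +ℤ k)) ⟩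
    binom²Term M N k j ∎
    where open ≡-Reasoning

binom²Term-vanishes : ∀ B M N k → M ℕ.≤ B → VanishesOutside B (binom²Term M N k)
binom²Term-vanishes B M N k M≤B (+ x) B<x =
  trans (cong (λ w → fact (M + N) *ℚ w *ℚ invFact (+ N -ℤ + x) *ℚ invFact± (+ x) k)
              (invFact-neg (i<j⇒i-j<0 (ℤ.+<+ (ℕP.≤-<-trans M≤B B<x)))))
        (solve 3 (λ a b c → a :* con 0ℚ :* b :* c := con 0ℚ) refl (fact (M + N)) (invFact (+ N -ℤ + x)) (invFact± (+ x) k))
binom²Term-vanishes B M N k M≤B -[1+ x ] _ =
  trans (cong (rest *ℚ_) (invFact±-neg x k)) (ℚP.*-zeroʳ rest)
  where
  rest = fact (M + N) *ℚ invFact (+ M -ℤ -[1+ x ]) *ℚ invFact (+ N -ℤ -[1+ x ])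

binom³Weight : ℕ → ℕ → ℕ → ℤ → ℚ
binom³Weight l m n j = factℤ (+ (l + m + n) -ℤ j) *ℚ invFact (+ l -ℤ j) *ℚ invFact (+ m -ℤ j) *ℚ invFact (+ n -ℤ j)

binom³Term : ℕ → ℕ → ℕ → ℤ → ℤ → ℚ
binom³Term l m n k j = binom³Weight l m n j *ℚ invFact± j k

-- Each binom³Term is a Vandermonde sum over i (binom³Term≡inner-sum); summing
-- over j first gives a shifted Vandermonde sum (inner-sum), and the remaining
-- sum over i is a third one (outer-sum).
module Binom³Expansion (l m n : ℕ) (k : ℤ) where

  L M N : ℤ
  L = + l
  M = + m
  N = + n

  inner : ℤ → ℤ → ℚ
  inner i j = fact (l + m) *ℚ fact (m + n) *ℚ (invFact (M -ℤ j) *ℚ invFact± j k)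
              *ℚ vandermondeTerm (L -ℤ j) (L +ℤ M) (N -ℤ L) i

  binom³Term≡inner-sum : ∀ j → binom³Term l m n k j ≡ sumℤ (l + m) (λ i → inner i j)
  binom³Term≡inner-sum j = sym (begin
    sumℤ (l + m) (λ i → inner i j)
      ≡⟨ sumℤ-*ˡ (l + m) w (vandermondeTerm (L -ℤ j) (L +ℤ M) (N -ℤ L)) ⟩
    w *ℚ sumℤ (l + m) (vandermondeTerm (L -ℤ j) (L +ℤ M) (N -ℤ L))
      ≡⟨ cong (w *ℚ_) (HasSum-sumℤ (vandermonde (L -ℤ j) (L +ℤ M) (N -ℤ L))
                                   (vandermondeTerm-vanishes (L -ℤ j) (L +ℤ M) (N -ℤ L) (l + m) ℤP.≤-refl)) ⟩
    w *ℚ (factℤ ((L -ℤ j) +ℤ (L +ℤ M) +ℤ (N -ℤ L)) *ℚ invFact (L -ℤ j) *ℚ invFact (L +ℤ M)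
          *ℚ (invFact ((L +ℤ M) +ℤ (N -ℤ L)) *ℚ invFact ((L -ℤ j) +ℤ (N -ℤ L))))
      ≡⟨ cong₂ (λ u v → w *ℚ (factℤ u *ℚ invFact (L -ℤ j) *ℚ invFact (L +ℤ M) *ℚ (invFact v *ℚ invFact ((L -ℤ j) +ℤ (N -ℤ L)))))
               (trans (e₁ L M N j) (cong (_-ℤ j) (sym (ℤP.pos-+ (l + m) n)))) (e₂ L M N) ⟩
    w *ℚ (factℤ (+ (l + m + n) -ℤ j) *ℚ invFact (L -ℤ j) *ℚ invFact (L +ℤ M) *ℚ (invFact (M +ℤ N) *ℚ invFact ((L -ℤ j) +ℤ (N -ℤ L))))
      ≡⟨ cong (λ v → w *ℚ (factℤ (+ (l + m + n) -ℤ j) *ℚ invFact (L -ℤ j) *ℚ invFact (L +ℤ M) *ℚ (invFact (M +ℤ N) *ℚ invFact v))) (e₃ L N j) ⟩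
    w *ℚ (factℤ (+ (l + m + n) -ℤ j) *ℚ invFact (L -ℤ j) *ℚ invFact (+ (l + m)) *ℚ (invFact (+ (m + n)) *ℚ invFact (N -ℤ j)))
      ≡⟨ solve 9 (λ a b x g f y c d z → a :* b :* (x :* g) :* (f :* y :* c :* (d :* z)) := (a :* c) :* (b :* d) :* (f :* y :* x :* z :* g)) refl
           (fact (l + m)) (fact (m + n)) (invFact (M -ℤ j)) (invFact± j k) (factℤ (+ (l + m + n) -ℤ j)) (invFact (L -ℤ j))
           (invFact (+ (l + m))) (invFact (+ (m + n))) (invFact (N -ℤ j)) ⟩
    (fact (l + m) *ℚ invFact (+ (l + m))) *ℚ (fact (m + n) *ℚ invFact (+ (m + n))) *ℚ binom³Term l m n k j
      ≡⟨ cong₂ (λ u v → u *ℚ v *ℚ binom³Term l m n k j) (fact*invFact (l + m)) (fact*invFact (m + n)) ⟩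
    1ℚ *ℚ 1ℚ *ℚ binom³Term l m n k j
      ≡⟨ solve 1 (λ x → con 1ℚ :* con 1ℚ :* x := x) refl (binom³Term l m n k j) ⟩
    binom³Term l m n k j ∎)
    where
    open ≡-Reasoning
    w = fact (l + m) *ℚ fact (m + n) *ℚ (invFact (M -ℤ j) *ℚ invFact± j k)
    e₁ : ∀ l m n j → (l -ℤ j) +ℤ (l +ℤ m) +ℤ (n -ℤ l) ≡ (l +ℤ m +ℤ n) -ℤ j
    e₁ = ℤRing.solve-∀
    e₂ : ∀ l m n → (l +ℤ m) +ℤ (n -ℤ l) ≡ m +ℤ n
    e₂ = ℤRing.solve-∀
    e₃ : ∀ l n j → (l -ℤ j) +ℤ (n -ℤ l) ≡ n -ℤ j
    e₃ = ℤRing.solve-∀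

  coeff : ℤ → ℚ
  coeff i = fact (l + m) *ℚ fact (m + n) *ℚ invFact i *ℚ invFact ((L +ℤ M) -ℤ i) *ℚ invFact ((N -ℤ L) +ℤ i)

  outer : ℤ → ℚ
  outer i = coeff i *ℚ vandermondeValue (L -ℤ i +ℤ k) (M +ℤ k) (-ℤ k -ℤ k)

  inner-sum : ∀ i → HasSum (λ j → inner i j) (outer i)
  inner-sum i = HasSum-cong term≡ (HasSum-*ˡ (coeff i) (HasSum-shift k (vandermonde (L -ℤ i +ℤ k) (M +ℤ k) (-ℤ k -ℤ k))))
    where
    e₁ : ∀ l i k j → l -ℤ i +ℤ k -ℤ (k +ℤ j) ≡ (l -ℤ j) -ℤ i
    e₁ = ℤRing.solve-∀
    e₂ : ∀ m k j → m +ℤ k -ℤ (k +ℤ j) ≡ m -ℤ j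
    e₂ = ℤRing.solve-∀
    e₃ : ∀ k j → -ℤ k -ℤ k +ℤ (k +ℤ j) ≡ j -ℤ k
    e₃ = ℤRing.solve-∀
    term≡ : ∀ j → coeff i *ℚ vandermondeTerm (L -ℤ i +ℤ k) (M +ℤ k) (-ℤ k -ℤ k) (k +ℤ j) ≡ inner i j
    term≡ j = begin
      coeff i *ℚ (invFact (k +ℤ j) *ℚ invFact (L -ℤ i +ℤ k -ℤ (k +ℤ j)) *ℚ (invFact (M +ℤ k -ℤ (k +ℤ j)) *ℚ invFact (-ℤ k -ℤ k +ℤ (k +ℤ j))))
        ≡⟨ cong₂ (λ u v → coeff i *ℚ (invFact u *ℚ invFact v *ℚ (invFact (M +ℤ k -ℤ (k +ℤ j)) *ℚ invFact (-ℤ k -ℤ k +ℤ (k +ℤ j)))))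
                 (ℤP.+-comm k j) (e₁ L i k j) ⟩
      coeff i *ℚ (invFact (j +ℤ k) *ℚ invFact ((L -ℤ j) -ℤ i) *ℚ (invFact (M +ℤ k -ℤ (k +ℤ j)) *ℚ invFact (-ℤ k -ℤ k +ℤ (k +ℤ j))))
        ≡⟨ cong₂ (λ u v → coeff i *ℚ (invFact (j +ℤ k) *ℚ invFact ((L -ℤ j) -ℤ i) *ℚ (invFact u *ℚ invFact v))) (e₂ M k j) (e₃ k j) ⟩
      coeff i *ℚ (invFact (j +ℤ k) *ℚ invFact ((L -ℤ j) -ℤ i) *ℚ (invFact (M -ℤ j) *ℚ invFact (j -ℤ k)))
        ≡⟨ solve 10 (λ a b x y z p q r s t → a :* b :* x :* y :* z :* (p :* q :* (r :* s)) := a :* b :* (r :* (p :* s)) :* (x :* q :* (y :* z)))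
             refl (fact (l + m)) (fact (m + n)) (invFact i) (invFact ((L +ℤ M) -ℤ i)) (invFact ((N -ℤ L) +ℤ i))
             (invFact (j +ℤ k)) (invFact ((L -ℤ j) -ℤ i)) (invFact (M -ℤ j)) (invFact (j -ℤ k)) 0ℚ ⟩
      inner i j ∎
      where open ≡-Reasoning

  scale : ℚ
  scale = fact (l + m) *ℚ fact (m + n) *ℚ invFact (M +ℤ k) *ℚ invFact (M -ℤ k)

  outer≡ : ∀ i → outer i ≡ scale *ℚ vandermondeTerm (L +ℤ k) (L -ℤ k) (N -ℤ L) i
  outer≡ i = begin
    coeff i *ℚ (factℤ (L -ℤ i +ℤ k +ℤ (M +ℤ k) +ℤ (-ℤ k -ℤ k)) *ℚ invFact (L -ℤ i +ℤ k) *ℚ invFact (M +ℤ k)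
               *ℚ (invFact (M +ℤ k +ℤ (-ℤ k -ℤ k)) *ℚ invFact (L -ℤ i +ℤ k +ℤ (-ℤ k -ℤ k))))
      ≡⟨ cong₂ (λ u v → coeff i *ℚ (factℤ u *ℚ invFact (L -ℤ i +ℤ k) *ℚ invFact (M +ℤ k) *ℚ (invFact v *ℚ invFact (L -ℤ i +ℤ k +ℤ (-ℤ k -ℤ k)))))
               (e₁ L M i k) (e₂ M k) ⟩
    coeff i *ℚ (factℤ x *ℚ invFact (L -ℤ i +ℤ k) *ℚ invFact (M +ℤ k) *ℚ (invFact (M -ℤ k) *ℚ invFact (L -ℤ i +ℤ k +ℤ (-ℤ k -ℤ k))))
      ≡⟨ cong₂ (λ u v → coeff i *ℚ (factℤ x *ℚ invFact u *ℚ invFact (M +ℤ k) *ℚ (invFact (M -ℤ k) *ℚ invFact v))) (e₃ L i k) (e₄ L i k) ⟩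
    coeff i *ℚ (factℤ x *ℚ invFact y *ℚ invFact (M +ℤ k) *ℚ (invFact (M -ℤ k) *ℚ invFact z))
      ≡⟨ solve 10 (λ a b ii xx nn fx y mp mm z → a :* b :* ii :* xx :* nn :* (fx :* y :* mp :* (mm :* z)) := a :* b :* mp :* mm :* (ii :* ((fx :* xx) :* (y :* z)) :* nn))
           refl (fact (l + m)) (fact (m + n)) (invFact i) (invFact x) (invFact ((N -ℤ L) +ℤ i)) (factℤ x) (invFact y)
           (invFact (M +ℤ k)) (invFact (M -ℤ k)) (invFact z) ⟩
    scale *ℚ (invFact i *ℚ (factℤ x *ℚ invFact x *ℚ (invFact y *ℚ invFact z)) *ℚ invFact ((N -ℤ L) +ℤ i))
      ≡⟨ cong (λ u → scale *ℚ (invFact i *ℚ u *ℚ invFact ((N -ℤ L) +ℤ i))) (factℤ*invFact-cancel x y z y+z≤2x) ⟩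
    scale *ℚ (invFact i *ℚ (invFact y *ℚ invFact z) *ℚ invFact ((N -ℤ L) +ℤ i))
      ≡⟨ cong (scale *ℚ_) (solve 4 (λ a b c d → a :* (b :* c) :* d := a :* b :* (c :* d)) refl
                                 (invFact i) (invFact y) (invFact z) (invFact ((N -ℤ L) +ℤ i))) ⟩
    scale *ℚ vandermondeTerm (L +ℤ k) (L -ℤ k) (N -ℤ L) i ∎
    where
    open ≡-Reasoning
    x = (L +ℤ M) -ℤ i
    y = (L +ℤ k) -ℤ i
    z = (L -ℤ k) -ℤ i
    e₁ : ∀ l m i k → l -ℤ i +ℤ k +ℤ (m +ℤ k) +ℤ (-ℤ k -ℤ k) ≡ (l +ℤ m) -ℤ i
    e₁ = ℤRing.solve-∀
    e₂ : ∀ m k → m +ℤ k +ℤ (-ℤ k -ℤ k) ≡ m -ℤ k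
    e₂ = ℤRing.solve-∀
    e₃ : ∀ l i k → l -ℤ i +ℤ k ≡ (l +ℤ k) -ℤ i
    e₃ = ℤRing.solve-∀
    e₄ : ∀ l i k → l -ℤ i +ℤ k +ℤ (-ℤ k -ℤ k) ≡ (l -ℤ k) -ℤ i
    e₄ = ℤRing.solve-∀
    e₅ : ∀ l m i k → ((l +ℤ k) -ℤ i) +ℤ ((l -ℤ k) -ℤ i) +ℤ (m +ℤ m) ≡ ((l +ℤ m) -ℤ i) +ℤ ((l +ℤ m) -ℤ i)
    e₅ = ℤRing.solve-∀
    y+z≤2x : y +ℤ z ℤ.≤ x +ℤ x
    y+z≤2x = subst₂ ℤ._≤_ (ℤP.+-identityʳ (y +ℤ z)) (e₅ L M i k) (ℤP.+-monoʳ-≤ (y +ℤ z) (ℤ.+≤+ ℕ.z≤n))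

  product : ℚ
  product = binom (l + m) (L +ℤ k) *ℚ binom (m + n) (M +ℤ k) *ℚ binom (n + l) (N +ℤ k)

  outer-sum : sumℤ (l + m) outer ≡ product
  outer-sum = begin
    sumℤ (l + m) outer
      ≡⟨ sumℤ-cong (l + m) outer≡ ⟩
    sumℤ (l + m) (λ i → scale *ℚ vandermondeTerm (L +ℤ k) (L -ℤ k) (N -ℤ L) i)
      ≡⟨ sumℤ-*ˡ (l + m) scale _ ⟩
    scale *ℚ sumℤ (l + m) (vandermondeTerm (L +ℤ k) (L -ℤ k) (N -ℤ L))
      ≡⟨ cong (scale *ℚ_) (HasSum-sumℤ (vandermonde (L +ℤ k) (L -ℤ k) (N -ℤ L))
                                       (vandermondeTerm-vanishes₂ (L +ℤ k) (L -ℤ k) (N -ℤ L) (l + m) 2L≤)) ⟩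
    scale *ℚ (factℤ ((L +ℤ k) +ℤ (L -ℤ k) +ℤ (N -ℤ L)) *ℚ invFact (L +ℤ k) *ℚ invFact (L -ℤ k)
              *ℚ (invFact ((L -ℤ k) +ℤ (N -ℤ L)) *ℚ invFact ((L +ℤ k) +ℤ (N -ℤ L))))
      ≡⟨ cong₂ (λ u v → scale *ℚ (factℤ u *ℚ invFact (L +ℤ k) *ℚ invFact (L -ℤ k) *ℚ (invFact v *ℚ invFact ((L +ℤ k) +ℤ (N -ℤ L)))))
               (e₁ L N k) (e₂ L N k) ⟩
    scale *ℚ (fact (n + l) *ℚ invFact (L +ℤ k) *ℚ invFact (L -ℤ k) *ℚ (invFact (N -ℤ k) *ℚ invFact ((L +ℤ k) +ℤ (N -ℤ L))))
      ≡⟨ cong (λ v → scale *ℚ (fact (n + l) *ℚ invFact (L +ℤ k) *ℚ invFact (L -ℤ k) *ℚ (invFact (N -ℤ k) *ℚ invFact v))) (e₃ L N k) ⟩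
    scale *ℚ (fact (n + l) *ℚ invFact (L +ℤ k) *ℚ invFact (L -ℤ k) *ℚ (invFact (N -ℤ k) *ℚ invFact (N +ℤ k)))
      ≡⟨ solve 9 (λ a b c d e f g h i → a :* b :* c :* d :* (e :* f :* g :* (h :* i)) := a :* f :* d :* (b :* c :* h) :* (e :* i :* g))
           refl (fact (l + m)) (fact (m + n)) (invFact (M +ℤ k)) (invFact (M -ℤ k)) (fact (n + l))
           (invFact (L +ℤ k)) (invFact (L -ℤ k)) (invFact (N -ℤ k)) (invFact (N +ℤ k)) ⟩
    fact (l + m) *ℚ invFact (L +ℤ k) *ℚ invFact (M -ℤ k) *ℚ (fact (m + n) *ℚ invFact (M +ℤ k) *ℚ invFact (N -ℤ k))
      *ℚ (fact (n + l) *ℚ invFact (N +ℤ k) *ℚ invFact (L -ℤ k))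
      ≡⟨ complements ⟩
    fact (l + m) *ℚ invFact (L +ℤ k) *ℚ invFact ((L +ℤ M) -ℤ (L +ℤ k))
      *ℚ (fact (m + n) *ℚ invFact (M +ℤ k) *ℚ invFact ((M +ℤ N) -ℤ (M +ℤ k)))
      *ℚ (fact (n + l) *ℚ invFact (N +ℤ k) *ℚ invFact ((N +ℤ L) -ℤ (N +ℤ k)))
      ≡⟨ sym (cong₂ _*ℚ_ (cong₂ _*ℚ_ (binom-invFact (l + m) (L +ℤ k)) (binom-invFact (m + n) (M +ℤ k))) (binom-invFact (n + l) (N +ℤ k))) ⟩
    product ∎
    where
    open ≡-Reasoning
    e₁ : ∀ l n k → (l +ℤ k) +ℤ (l -ℤ k) +ℤ (n -ℤ l) ≡ n +ℤ l
    e₁ = ℤRing.solve-∀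
    e₂ : ∀ l n k → (l -ℤ k) +ℤ (n -ℤ l) ≡ n -ℤ k
    e₂ = ℤRing.solve-∀
    e₃ : ∀ l n k → (l +ℤ k) +ℤ (n -ℤ l) ≡ n +ℤ k
    e₃ = ℤRing.solve-∀
    complement : ∀ a b k → b -ℤ k ≡ (a +ℤ b) -ℤ (a +ℤ k)
    complement = ℤRing.solve-∀
    complements : fact (l + m) *ℚ invFact (L +ℤ k) *ℚ invFact (M -ℤ k) *ℚ (fact (m + n) *ℚ invFact (M +ℤ k) *ℚ invFact (N -ℤ k))
               *ℚ (fact (n + l) *ℚ invFact (N +ℤ k) *ℚ invFact (L -ℤ k))
           ≡ fact (l + m) *ℚ invFact (L +ℤ k) *ℚ invFact ((L +ℤ M) -ℤ (L +ℤ k))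
               *ℚ (fact (m + n) *ℚ invFact (M +ℤ k) *ℚ invFact ((M +ℤ N) -ℤ (M +ℤ k)))
               *ℚ (fact (n + l) *ℚ invFact (N +ℤ k) *ℚ invFact ((N +ℤ L) -ℤ (N +ℤ k)))
    complements rewrite complement L M k | complement M N k | complement N L k = refl
    2L≤ : (L +ℤ k) +ℤ (L -ℤ k) ℤ.≤ + (l + m) +ℤ + (l + m)
    2L≤ = subst₂ ℤ._≤_ (e L k) refl (ℤP.+-mono-≤ (ℤ.+≤+ (ℕP.m≤m+n l m)) (ℤ.+≤+ (ℕP.m≤m+n l m)))
      where
      e : ∀ l k → l +ℤ l ≡ (l +ℤ k) +ℤ (l -ℤ k)
      e = ℤRing.solve-∀

  binom³-expansion : HasSum (binom³Term l m n k) product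
  binom³-expansion = subst (HasSum _) outer-sum
    (HasSum-cong (λ j → sym (binom³Term≡inner-sum j)) (HasSum-sumℤ-family (l + m) inner-sum))

open Binom³Expansion using (binom³-expansion)

binom³Term-vanishes : ∀ B l m n k → l ℕ.≤ B → VanishesOutside B (binom³Term l m n k)
binom³Term-vanishes B l m n k l≤B (+ x) B<x =
  trans (cong (λ w → factℤ (+ (l + m + n) -ℤ + x) *ℚ w *ℚ invFact (+ m -ℤ + x) *ℚ invFact (+ n -ℤ + x) *ℚ invFact± (+ x) k)
              (invFact-neg (i<j⇒i-j<0 (ℤ.+<+ (ℕP.≤-<-trans l≤B B<x)))))
        (solve 4 (λ a b c d → a :* con 0ℚ :* b :* c :* d := con 0ℚ) refl
               (factℤ (+ (l + m + n) -ℤ + x)) (invFact (+ m -ℤ + x)) (invFact (+ n -ℤ + x)) (invFact± (+ x) k))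
binom³Term-vanishes B l m n k l≤B -[1+ x ] _ =
  trans (cong (rest *ℚ_) (invFact±-neg x k)) (ℚP.*-zeroʳ rest)
  where
  rest = factℤ (+ (l + m + n) -ℤ -[1+ x ]) *ℚ invFact (+ l -ℤ -[1+ x ]) *ℚ invFact (+ m -ℤ -[1+ x ]) *ℚ invFact (+ n -ℤ -[1+ x ])

-- The two identities

identity₁-summand : ∀ l m n u B k → l ℕ.≤ B →
  sign k *ℚ binom (l + m) (+ l +ℤ k) *ℚ binom (m + n) (+ m +ℤ k) *ℚ binom (n + l) (+ n +ℤ k) *ℚ binom (2 * u) (+ u +ℤ k)
    ≡ sumℤ B (λ j → (fact (2 * u) *ℚ binom³Weight l m n j) *ℚ altTerm j (+ u) k)
identity₁-summand l m n u B k l≤B = begin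
  sign k *ℚ b₁ *ℚ b₂ *ℚ b₃ *ℚ binom (2 * u) (+ u +ℤ k)
    ≡⟨ cong (sign k *ℚ b₁ *ℚ b₂ *ℚ b₃ *ℚ_) (binom-central u k) ⟩
  sign k *ℚ b₁ *ℚ b₂ *ℚ b₃ *ℚ (fact (2 * u) *ℚ invFact± (+ u) k)
    ≡⟨ solve 6 (λ s x y z f g → s :* x :* y :* z :* (f :* g) := (s :* f :* g) :* (x :* y :* z)) refl
         (sign k) b₁ b₂ b₃ (fact (2 * u)) (invFact± (+ u) k) ⟩
  c *ℚ (b₁ *ℚ b₂ *ℚ b₃)
    ≡⟨ cong (c *ℚ_) (sym (HasSum-sumℤ (binom³-expansion l m n k) (binom³Term-vanishes B l m n k l≤B))) ⟩
  c *ℚ sumℤ B (binom³Term l m n k)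
    ≡⟨ sym (sumℤ-*ˡ B c (binom³Term l m n k)) ⟩
  sumℤ B (λ j → c *ℚ binom³Term l m n k j)
    ≡⟨ sumℤ-cong B (λ j → solve 5 (λ s f g x y → (s :* f :* g) :* (x :* y) := (f :* x) :* (s :* (y :* g))) refl
                            (sign k) (fact (2 * u)) (invFact± (+ u) k) (binom³Weight l m n j) (invFact± j k)) ⟩
  sumℤ B (λ j → (fact (2 * u) *ℚ binom³Weight l m n j) *ℚ altTerm j (+ u) k) ∎
  where
  open ≡-Reasoning
  b₁ = binom (l + m) (+ l +ℤ k)
  b₂ = binom (m + n) (+ m +ℤ k)
  b₃ = binom (n + l) (+ n +ℤ k)
  c = sign k *ℚ fact (2 * u) *ℚ invFact± (+ u) k

identity₁ : ∀ l m n u B → l ℕ.≤ B → u ℕ.≤ B →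
  sumℤ B (λ k → sign k *ℚ binom (l + m) (+ l +ℤ k) *ℚ binom (m + n) (+ m +ℤ k)
                 *ℚ binom (n + l) (+ n +ℤ k) *ℚ binom (2 * u) (+ u +ℤ k))
  ≡ (fact (2 * u) *ℚ invFact (+ u))
    *ℚ sumℕ B (λ k → factℤ (+ (l + m + n) -ℤ + k) *ℚ invFact (+ k) *ℚ invFact (+ l -ℤ + k)
                      *ℚ invFact (+ m -ℤ + k) *ℚ invFact (+ n -ℤ + k) *ℚ invFact (+ (u + k)))
identity₁ l m n u B l≤B u≤B = begin
  sumℤ B summand                                                             ≡⟨ HasSum-sumℤ summand-sum summand-vanishes ⟩
  sumℤ B (λ j → (fact (2 * u) *ℚ binom³Weight l m n j) *ℚ altValue j (+ u)) ≡⟨ sumℤ-cong B regroup ⟩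
  sumℤ B (λ j → (fact (2 * u) *ℚ invFact (+ u)) *ℚ t j)                     ≡⟨ sumℤ-*ˡ B (fact (2 * u) *ℚ invFact (+ u)) t ⟩
  (fact (2 * u) *ℚ invFact (+ u)) *ℚ sumℤ B t                               ≡⟨ cong (fact (2 * u) *ℚ invFact (+ u) *ℚ_) (sym (sumℕ≡sumℤ B t t-neg)) ⟩
  (fact (2 * u) *ℚ invFact (+ u)) *ℚ sumℕ B (λ k → t (+ k))                 ∎
  where
  open ≡-Reasoning
  summand : ℤ → ℚ
  summand k = sign k *ℚ binom (l + m) (+ l +ℤ k) *ℚ binom (m + n) (+ m +ℤ k) *ℚ binom (n + l) (+ n +ℤ k) *ℚ binom (2 * u) (+ u +ℤ k)
  t : ℤ → ℚ
  t j = factℤ (+ (l + m + n) -ℤ j) *ℚ invFact j *ℚ invFact (+ l -ℤ j) *ℚ invFact (+ m -ℤ j) *ℚ invFact (+ n -ℤ j) *ℚ invFact (+ u +ℤ j)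
  t-neg : ∀ x → t -[1+ x ] ≡ 0ℚ
  t-neg x = solve 5 (λ a b c d e → a :* con 0ℚ :* b :* c :* d :* e := con 0ℚ) refl
              (factℤ (+ (l + m + n) -ℤ -[1+ x ])) (invFact (+ l -ℤ -[1+ x ])) (invFact (+ m -ℤ -[1+ x ]))
              (invFact (+ n -ℤ -[1+ x ])) (invFact (+ u +ℤ -[1+ x ]))
  summand-sum : HasSum summand (sumℤ B (λ j → (fact (2 * u) *ℚ binom³Weight l m n j) *ℚ altValue j (+ u)))
  summand-sum = HasSum-cong (λ k → sym (identity₁-summand l m n u B k l≤B))
                  (HasSum-sumℤ-family B (λ j → HasSum-*ˡ (fact (2 * u) *ℚ binom³Weight l m n j) (altSum j (+ u))))
  summand-vanishes : VanishesOutside B summand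
  summand-vanishes k B<k =
    trans (cong (sign k *ℚ binom (l + m) (+ l +ℤ k) *ℚ binom (m + n) (+ m +ℤ k) *ℚ binom (n + l) (+ n +ℤ k) *ℚ_)
                (trans (binom-central u k) (trans (cong (fact (2 * u) *ℚ_) (invFact±-vanishes u k (ℕP.≤-<-trans u≤B B<k)))
                                                  (ℚP.*-zeroʳ (fact (2 * u))))))
          (ℚP.*-zeroʳ (sign k *ℚ binom (l + m) (+ l +ℤ k) *ℚ binom (m + n) (+ m +ℤ k) *ℚ binom (n + l) (+ n +ℤ k)))
  regroup : ∀ j → (fact (2 * u) *ℚ binom³Weight l m n j) *ℚ altValue j (+ u) ≡ (fact (2 * u) *ℚ invFact (+ u)) *ℚ t j
  regroup j = trans (cong (λ w → (fact (2 * u) *ℚ binom³Weight l m n j) *ℚ (invFact j *ℚ invFact (+ u) *ℚ invFact w)) (ℤP.+-comm j (+ u)))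
    (solve 8 (λ f fz il im in′ ij iu iuj → (f :* (fz :* il :* im :* in′)) :* (ij :* iu :* iuj) := (f :* iu) :* (fz :* ij :* il :* im :* in′ :* iuj)) refl
       (fact (2 * u)) (factℤ (+ (l + m + n) -ℤ j)) (invFact (+ l -ℤ j)) (invFact (+ m -ℤ j)) (invFact (+ n -ℤ j))
       (invFact j) (invFact (+ u)) (invFact (+ u +ℤ j)))

identity₂-summand : ∀ m n u v B k → m ℕ.≤ B → u ℕ.≤ B →
  sign k *ℚ binom (m + n) (+ m +ℤ k) *ℚ binom (m + n) (+ n +ℤ k) *ℚ binom (u + v) (+ u +ℤ k) *ℚ binom (u + v) (+ v +ℤ k)
    ≡ sumℤ B (λ i → sumℤ B (λ j → (binom²Weight m n i *ℚ binom²Weight u v j) *ℚ altTerm i j k))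
identity₂-summand m n u v B k m≤B u≤B = begin
  sign k *ℚ b₁ *ℚ b₂ *ℚ b₃ *ℚ b₄
    ≡⟨ solve 5 (λ s x y z w → s :* x :* y :* z :* w := s :* ((x :* y) :* (z :* w))) refl (sign k) b₁ b₂ b₃ b₄ ⟩
  sign k *ℚ ((b₁ *ℚ b₂) *ℚ (b₃ *ℚ b₄))
    ≡⟨ cong₂ (λ p r → sign k *ℚ (p *ℚ r))
             (sym (HasSum-sumℤ (binom²-expansion m n k) (binom²Term-vanishes B m n k m≤B)))
             (sym (HasSum-sumℤ (binom²-expansion u v k) (binom²Term-vanishes B u v k u≤B))) ⟩
  sign k *ℚ (sumℤ B (binom²Term m n k) *ℚ sumℤ B (binom²Term u v k))
    ≡⟨ cong (sign k *ℚ_) (sumℤ*sumℤ B (binom²Term m n k) (binom²Term u v k)) ⟩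
  sign k *ℚ sumℤ B (λ i → sumℤ B (λ j → binom²Term m n k i *ℚ binom²Term u v k j))
    ≡⟨ sym (sumℤ-*ˡ B (sign k) _) ⟩
  sumℤ B (λ i → sign k *ℚ sumℤ B (λ j → binom²Term m n k i *ℚ binom²Term u v k j))
    ≡⟨ sumℤ-cong B (λ i → sym (sumℤ-*ˡ B (sign k) (λ j → binom²Term m n k i *ℚ binom²Term u v k j))) ⟩
  sumℤ B (λ i → sumℤ B (λ j → sign k *ℚ (binom²Term m n k i *ℚ binom²Term u v k j)))
    ≡⟨ sumℤ-cong B (λ i → sumℤ-cong B (λ j → solve 5 (λ s a gi b gj → s :* ((a :* gi) :* (b :* gj)) := (a :* b) :* (s :* (gi :* gj))) refl
                                                      (sign k) (binom²Weight m n i) (invFact± i k) (binom²Weight u v j) (invFact± j k))) ⟩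
  sumℤ B (λ i → sumℤ B (λ j → (binom²Weight m n i *ℚ binom²Weight u v j) *ℚ altTerm i j k)) ∎
  where
  open ≡-Reasoning
  b₁ = binom (m + n) (+ m +ℤ k)
  b₂ = binom (m + n) (+ n +ℤ k)
  b₃ = binom (u + v) (+ u +ℤ k)
  b₄ = binom (u + v) (+ v +ℤ k)

identity₂-inner : ∀ m n u v B i → v ℕ.≤ B →
  sumℤ B (λ j → (binom²Weight m n i *ℚ binom²Weight u v j) *ℚ altValue i j)
    ≡ (fact (u + v) *ℚ invFact (+ u) *ℚ invFact (+ v))
      *ℚ (fact (m + n) *ℚ factℤ (+ (u + v) +ℤ i) *ℚ invFact i *ℚ invFact (+ m -ℤ i) *ℚ invFact (+ n -ℤ i)
          *ℚ invFact (+ u +ℤ i) *ℚ invFact (+ v +ℤ i))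
identity₂-inner m n u v B i v≤B = begin
  sumℤ B (λ j → (binom²Weight m n i *ℚ binom²Weight u v j) *ℚ altValue i j)
    ≡⟨ sumℤ-cong B (λ j → solve 9 (λ fa im in′ fb iu iv ii ij iij → (fa :* im :* in′ :* (fb :* iu :* iv)) :* (ii :* ij :* iij)
                                                                  := (fa :* im :* in′ :* ii :* fb) :* (ij :* iu :* (iv :* iij))) refl
           (fact (m + n)) (invFact (+ m -ℤ i)) (invFact (+ n -ℤ i)) (fact (u + v)) (invFact (+ u -ℤ j)) (invFact (+ v -ℤ j))
           (invFact i) (invFact j) (invFact (i +ℤ j))) ⟩
  sumℤ B (λ j → c *ℚ vandermondeTerm (+ u) (+ v) i j)
    ≡⟨ sumℤ-*ˡ B c (vandermondeTerm (+ u) (+ v) i) ⟩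
  c *ℚ sumℤ B (vandermondeTerm (+ u) (+ v) i)
    ≡⟨ cong (c *ℚ_) (HasSum-sumℤ (vandermonde (+ u) (+ v) i) (vandermondeTerm-vanishes (+ u) (+ v) i B (ℤ.+≤+ v≤B))) ⟩
  c *ℚ (factℤ (+ (u + v) +ℤ i) *ℚ invFact (+ u) *ℚ invFact (+ v) *ℚ (invFact (+ v +ℤ i) *ℚ invFact (+ u +ℤ i)))
    ≡⟨ solve 10 (λ fa im in′ ii fb fz iu iv ivi iui → (fa :* im :* in′ :* ii :* fb) :* (fz :* iu :* iv :* (ivi :* iui))
                                                   := (fb :* iu :* iv) :* (fa :* fz :* ii :* im :* in′ :* iui :* ivi)) refl
         (fact (m + n)) (invFact (+ m -ℤ i)) (invFact (+ n -ℤ i)) (invFact i) (fact (u + v)) (factℤ (+ (u + v) +ℤ i))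
         (invFact (+ u)) (invFact (+ v)) (invFact (+ v +ℤ i)) (invFact (+ u +ℤ i)) ⟩
  (fact (u + v) *ℚ invFact (+ u) *ℚ invFact (+ v))
    *ℚ (fact (m + n) *ℚ factℤ (+ (u + v) +ℤ i) *ℚ invFact i *ℚ invFact (+ m -ℤ i) *ℚ invFact (+ n -ℤ i)
        *ℚ invFact (+ u +ℤ i) *ℚ invFact (+ v +ℤ i)) ∎
  where
  open ≡-Reasoning
  c = binom²Weight m n i *ℚ invFact i *ℚ fact (u + v)

identity₂ : ∀ m n u v B → m ℕ.≤ B → u ℕ.≤ B → v ℕ.≤ B →
  sumℤ B (λ k → sign k *ℚ binom (m + n) (+ m +ℤ k) *ℚ binom (m + n) (+ n +ℤ k)
                 *ℚ binom (u + v) (+ u +ℤ k) *ℚ binom (u + v) (+ v +ℤ k))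
  ≡ binom (u + v) (+ u)
    *ℚ sumℕ B (λ k → fact (m + n) *ℚ fact (u + v + k) *ℚ invFact (+ k)
                      *ℚ invFact (+ m -ℤ + k) *ℚ invFact (+ n -ℤ + k)
                      *ℚ invFact (+ (u + k)) *ℚ invFact (+ (v + k)))
identity₂ m n u v B m≤B u≤B v≤B = begin
  sumℤ B summand
    ≡⟨ HasSum-sumℤ summand-sum summand-vanishes ⟩
  sumℤ B (λ i → sumℤ B (λ j → (binom²Weight m n i *ℚ binom²Weight u v j) *ℚ altValue i j))
    ≡⟨ sumℤ-cong B (λ i → identity₂-inner m n u v B i v≤B) ⟩
  sumℤ B (λ i → (fact (u + v) *ℚ invFact (+ u) *ℚ invFact (+ v)) *ℚ h i)
    ≡⟨ sumℤ-*ˡ B (fact (u + v) *ℚ invFact (+ u) *ℚ invFact (+ v)) h ⟩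
  (fact (u + v) *ℚ invFact (+ u) *ℚ invFact (+ v)) *ℚ sumℤ B h
    ≡⟨ cong₂ _*ℚ_ (sym (trans (binom-invFact (u + v) (+ u)) (cong (λ w → fact (u + v) *ℚ invFact (+ u) *ℚ invFact w) (e (+ u) (+ v)))))
                  (sym (sumℕ≡sumℤ B h h-neg)) ⟩
  binom (u + v) (+ u) *ℚ sumℕ B (λ k → h (+ k)) ∎
  where
  open ≡-Reasoning
  e : ∀ u v → (u +ℤ v) -ℤ u ≡ v
  e = ℤRing.solve-∀
  summand : ℤ → ℚ
  summand k = sign k *ℚ binom (m + n) (+ m +ℤ k) *ℚ binom (m + n) (+ n +ℤ k) *ℚ binom (u + v) (+ u +ℤ k) *ℚ binom (u + v) (+ v +ℤ k)
  h : ℤ → ℚ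
  h i = fact (m + n) *ℚ factℤ (+ (u + v) +ℤ i) *ℚ invFact i *ℚ invFact (+ m -ℤ i) *ℚ invFact (+ n -ℤ i) *ℚ invFact (+ u +ℤ i) *ℚ invFact (+ v +ℤ i)
  h-neg : ∀ x → h -[1+ x ] ≡ 0ℚ
  h-neg x = solve 6 (λ a b c d e f → a :* b :* con 0ℚ :* c :* d :* e :* f := con 0ℚ) refl
              (fact (m + n)) (factℤ (+ (u + v) +ℤ -[1+ x ])) (invFact (+ m -ℤ -[1+ x ])) (invFact (+ n -ℤ -[1+ x ]))
              (invFact (+ u +ℤ -[1+ x ])) (invFact (+ v +ℤ -[1+ x ]))
  summand-sum : HasSum summand (sumℤ B (λ i → sumℤ B (λ j → (binom²Weight m n i *ℚ binom²Weight u v j) *ℚ altValue i j)))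
  summand-sum = HasSum-cong (λ k → sym (identity₂-summand m n u v B k m≤B u≤B))
    (HasSum-sumℤ-family B (λ i → HasSum-sumℤ-family B (λ j → HasSum-*ˡ (binom²Weight m n i *ℚ binom²Weight u v j) (altSum i j))))
  summand-vanishes : VanishesOutside B summand
  summand-vanishes k B<k =
    trans (cong (λ w → sign k *ℚ binom (m + n) (+ m +ℤ k) *ℚ binom (m + n) (+ n +ℤ k) *ℚ w *ℚ binom (u + v) (+ v +ℤ k))
                (binom-outside (u + v) (+ u +ℤ k) (outside k B<k)))
          (solve 4 (λ a b c d → a :* b :* c :* con 0ℚ :* d := con 0ℚ) refl
                 (sign k) (binom (m + n) (+ m +ℤ k)) (binom (m + n) (+ n +ℤ k)) (binom (u + v) (+ v +ℤ k)))
    where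
    outside : ∀ k → B ℕ.< ℤ.∣ k ∣ → + u +ℤ k ℤ.< + 0 ⊎ + (u + v) ℤ.< + u +ℤ k
    outside (+ x)    B<x = inj₂ (ℤ.+<+ (ℕP.+-monoʳ-< u (ℕP.≤-<-trans v≤B B<x)))
    outside -[1+ x ] B<x = inj₁ (m<n⇒m⊖n<0 (ℕP.≤-<-trans u≤B B<x))

corollary5p9 : (l m n u v : ℕ) →
    let B = l + m + n + u + v in
    (sumℤ B (λ k → sign k *ℚ binom (l + m) (+ l +ℤ k) *ℚ binom (m + n) (+ m +ℤ k)
                     *ℚ binom (n + l) (+ n +ℤ k) *ℚ binom (2 * u) (+ u +ℤ k))
      ≡ (fact (2 * u) *ℚ invFact (+ u))
        *ℚ sumℕ B (λ k → factℤ (+ (l + m + n) -ℤ + k) *ℚ invFact (+ k)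
                     *ℚ invFact (+ l -ℤ + k) *ℚ invFact (+ m -ℤ + k)
                     *ℚ invFact (+ n -ℤ + k) *ℚ invFact (+ (u + k))))
    ×
    (sumℤ B (λ k → sign k *ℚ binom (m + n) (+ m +ℤ k) *ℚ binom (m + n) (+ n +ℤ k)
                     *ℚ binom (u + v) (+ u +ℤ k) *ℚ binom (u + v) (+ v +ℤ k))
      ≡ binom (u + v) (+ u)
        *ℚ sumℕ B (λ k → fact (m + n) *ℚ fact (u + v + k) *ℚ invFact (+ k)
                     *ℚ invFact (+ m -ℤ + k) *ℚ invFact (+ n -ℤ + k)
                     *ℚ invFact (+ (u + k)) *ℚ invFact (+ (v + k))))
corollary5p9 l m n u v =
  identity₁ l m n u B l≤B u≤B , identity₂ m n u v B m≤B u≤B v≤B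
  where
  B = l + m + n + u + v
  l≤B : l ℕ.≤ B
  l≤B = ℕP.≤-trans (ℕP.m≤m+n l m) (ℕP.≤-trans (ℕP.m≤m+n _ n) (ℕP.≤-trans (ℕP.m≤m+n _ u) (ℕP.m≤m+n _ v)))
  m≤B : m ℕ.≤ B
  m≤B = ℕP.≤-trans (ℕP.m≤n+m m l) (ℕP.≤-trans (ℕP.m≤m+n _ n) (ℕP.≤-trans (ℕP.m≤m+n _ u) (ℕP.m≤m+n _ v)))
  u≤B : u ℕ.≤ B
  u≤B = ℕP.≤-trans (ℕP.m≤n+m u (l + m + n)) (ℕP.m≤m+n _ v)
  v≤B : v ℕ.≤ B
  v≤B = ℕP.m≤n+m v _
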